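{- Let $(C_n)_{n\geq1}$ and $(\delta_k)_{k\geq0}$ be formal variables with $\delta_0=1$, and define moments $M_m=\sum_{\pi\in\mathrm{NC}_m}\operatorname{wt}(\pi)\prod_{B\in\pi}C_{\#B}$ for $m\geq1$. Then for every $n\geq1$, \[ C_n=\sum_{T\in\mathcal{S}'_n}\Big(\prod_{B\in\eta(T)}M_{\#B}\Big)(-1)^{\#\operatorname{int}(T)-1}\operatorname{wt}(T), \] where $\operatorname{int}(T)$ is the set of internal vertices of $T$.
   Context: $\mathrm{NC}_m$ is the set of noncrossing partitions of $\{1,\dots,m\}$ (set partitions with no $i<j<k<l$ such that $i,k$ are in one block and $j,l$ in another). The arcs of $\pi$ are pairs $(i,j)$, $i<j$, in the same block with no element of that block strictly between them, and Yoshida's weight is $\operatorname{wt}(\pi)=\prod_{(i,j)\text{ arc of }\pi}\delta_{j-i-1}$. Schröder trees: $\mathcal{S}_n$ is the set of plane trees with $n+1$ leaves in which every internal vertex has at least $2$ children. Among the edges from an internal vertex to its children, the leftmost is the left edge, the rightmost is the right edge, the others are middle edges. $\mathcal{S}'_n\subset\mathcal{S}_n$ (prime trees) consists of the trees whose root's right edge goes to a leaf. The map $\eta:\mathcal{S}'_n\to\mathrm{NC}_n$: draw $T$ with all leaves on a horizontal line, place label $i$ between the $i$-th and $(i+1)$-st leaves; then $i$ and $j$ are in the same block of $\eta(T)$ iff a path from label $i$ to label $j$ can be drawn staying above the level of the leaves and crossing only middle edges of $T$. The left branch of $T$ is the path from the root to the leftmost leaf; $\operatorname{int}'(T)$ is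 the set of internal vertices not on the left branch; $\deg(v)$ is the number of children of $v$; $\operatorname{wt}(T)=\prod_{v\in\operatorname{int}'(T)}\delta_{\deg(v)-1}$. -}

module Defs where

open import Level using (Level)
open import Data.Bool using (Bool; true; false; if_then_else_; _∧_; not)
open import Data.Nat using (ℕ; zero; suc; _+_; _∸_; _≡ᵇ_; _<ᵇ_; _≤ᵇ_)
open import Data.List.Base using (List; []; _∷_; _++_; map; concatMap; filterᵇ; upTo; length; foldr)
open import Algebra.Bundles using (CommutativeRing)
open import Data.Product using (_×_; _,_)

-- A set partition of {1,…,m} is encoded canonically by its restricted
-- growth string (a₁,…,aₘ): a₁ = 0, aᵢ ≤ 1 + max(a₁,…,aᵢ₋₁); positions i
-- and j lie in the same block iff aᵢ = aⱼ.  Positions are 0-indexed below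
-- (only differences of positions matter).

allᵇ : {A : Set} → (A → Bool) → List A → Bool
allᵇ p = foldr (λ x b → p x ∧ b) true

-- rgsAux r k : all continuations of length r when k block labels are in use
rgsAux : ℕ → ℕ → List (List ℕ)
rgsAux zero    k = [] ∷ []
rgsAux (suc r) k =
  concatMap (λ a → map (a ∷_) (rgsAux r (if a ≡ᵇ k then suc k else k))) (upTo (suc k))

setPartitions : ℕ → List (List ℕ)
setPartitions m = rgsAux m 0

at : List ℕ → ℕ → ℕ
at []       _       = 0
at (x ∷ xs) zero    = x
at (x ∷ xs) (suc i) = at xs i

sameBlock : List ℕ → ℕ → ℕ → Bool
sameBlock p i j = at p i ≡ᵇ at p j

isNoncrossing : List ℕ → Bool
isNoncrossing p =
  allᵇ (λ i → allᵇ (λ j → allᵇ (λ k → allᵇ (λ l →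
    not ((i <ᵇ j) ∧ (j <ᵇ k) ∧ (k <ᵇ l) ∧
         sameBlock p i k ∧ sameBlock p j l ∧ not (sameBlock p i j)))
    pos) pos) pos) pos
  where pos = upTo (length p)

NC : ℕ → List (List ℕ)
NC m = filterᵇ isNoncrossing (setPartitions m)

arcs : List ℕ → List (ℕ × ℕ)
arcs p = concatMap (λ i → concatMap (λ j →
           if (i <ᵇ j) ∧ sameBlock p i j ∧
              allᵇ (λ k → not ((i <ᵇ k) ∧ (k <ᵇ j) ∧ sameBlock p i k)) pos
           then (i , j) ∷ [] else []) pos) pos
  where
    pos = upTo (length p)

blockSizes : List ℕ → List ℕ
blockSizes p = filterᵇ (λ s → 1 ≤ᵇ s)
  (map (λ b → length (filterᵇ (λ x → x ≡ᵇ b) p)) (upTo (length p)))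

data Tree : Set where
  leaf : Tree
  node : List Tree → Tree

mutual
  leaves : Tree → ℕ
  leaves leaf        = 1
  leaves (node cs)   = leavesF cs

  leavesF : List Tree → ℕ
  leavesF []       = 0
  leavesF (c ∷ cs) = leaves c + leavesF cs

-- Generation of all plane trees with exactly n leaves in which every
-- internal vertex has ≥ 2 children.  Arguments f, g are fuel.
mutual
  treesF : ℕ → ℕ → List Tree
  treesF zero    n = []
  treesF (suc f) n =
    (if n ≡ᵇ 1 then leaf ∷ [] else []) ++
    map node (filterᵇ (λ cs → 2 ≤ᵇ length cs) (forestsF f n n))

  forestsF : ℕ → ℕ → ℕ → List (List Tree)
  forestsF f g       zero    = [] ∷ []
  forestsF f zero    (suc n) = []
  forestsF f (suc g) (suc n) =
    concatMap (λ k → concatMap (λ t → map (t ∷_) (forestsF f g (suc n ∸ k)))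
                                (treesF f k))
              (map suc (upTo (suc n)))

-- 𝒮_n : Schröder trees with n+1 leaves (depth ≤ n and ≤ n+1 children
-- per vertex, so the fuel n+2, n+1 suffices)
Schroeder : ℕ → List Tree
Schroeder n = treesF (suc (suc n)) (suc n)

lastIsLeaf : List Tree → Bool
lastIsLeaf []            = false
lastIsLeaf (leaf ∷ [])   = true
lastIsLeaf (node _ ∷ []) = false
lastIsLeaf (_ ∷ c ∷ cs)  = lastIsLeaf (c ∷ cs)

isPrime : Tree → Bool
isPrime leaf      = false
isPrime (node cs) = lastIsLeaf cs

SchroederPrime : ℕ → List Tree
SchroederPrime n = filterᵇ isPrime (Schroeder n)

-- η(T): label i sits between leaves i and i+1.  Two labels are joined by a
-- path above the leaves crossing only middle edges iff they are gaps
-- between consecutive children of one and the same internal vertex; so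
-- η(T) has one block per internal vertex v, consisting of the labels of
-- the gaps between consecutive children of v.  Offset o = number of leaves
-- to the left of the current subtree.
gapsF : ℕ → List Tree → List ℕ
gapsF o []           = []
gapsF o (c ∷ [])     = []
gapsF o (c ∷ c' ∷ cs) = (o + leaves c) ∷ gapsF (o + leaves c) (c' ∷ cs)

mutual
  etaT : ℕ → Tree → List (List ℕ)
  etaT o leaf      = []
  etaT o (node cs) = gapsF o cs ∷ etaF o cs

  etaF : ℕ → List Tree → List (List ℕ)
  etaF o []       = []
  etaF o (c ∷ cs) = etaT o c ++ etaF (o + leaves c) cs

eta : Tree → List (List ℕ)
eta = etaT 0

mutual
  numInternal : Tree → ℕ
  numInternal leaf      = 0
  numInternal (node cs) = suc (numInternalF cs)

  numInternalF : List Tree → ℕ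
  numInternalF []       = 0
  numInternalF (c ∷ cs) = numInternal c + numInternalF cs

-- degrees of the vertices in int'(T) (internal vertices not on the left
-- branch).  The flag says whether the current vertex lies on the left branch.
mutual
  intPrimeDegs : Bool → Tree → List ℕ
  intPrimeDegs b leaf      = []
  intPrimeDegs b (node cs) =
    (if b then [] else length cs ∷ []) ++ childDegs b cs

  childDegs : Bool → List Tree → List ℕ
  childDegs b []       = []
  childDegs b (c ∷ cs) = intPrimeDegs b c ++ childDegs false cs

module Formulas {c ℓ : Level} (R : CommutativeRing c ℓ) where
  open CommutativeRing R using (Carrier; 0#; 1#; -_) renaming (_+_ to _+R_; _*_ to _*R_)

  sumR : List Carrier → Carrier
  sumR = foldr _+R_ 0#

  prodR : List Carrier → Carrier
  prodR = foldr _*R_ 1#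

  negOnePow : ℕ → Carrier
  negOnePow zero    = 1#
  negOnePow (suc k) = - negOnePow k

  module _ (C : ℕ → Carrier) (δ : ℕ → Carrier) where

    wtNC : List ℕ → Carrier
    wtNC p = prodR (map (λ { (i , j) → δ (j ∸ i ∸ 1) }) (arcs p))

    M : ℕ → Carrier
    M m = sumR (map (λ p → wtNC p *R prodR (map C (blockSizes p))) (NC m))

    wtT : Tree → Carrier
    wtT T = prodR (map (λ d → δ (d ∸ 1)) (intPrimeDegs true T))

    rhs : ℕ → Carrier
    rhs n = sumR (map (λ T → prodR (map (λ B → M (length B)) (eta T))
                             *R negOnePow (numInternal T ∸ 1) *R wtT T)
                      (SchroederPrime n))

module Submission where

-- The proof is by generating functions over an arbitrary commutative ring,
-- with formal power series as coefficient sequences.  Three facts combine: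
--   (N) the moments satisfy M = 1 + z Σ_k C_{k+1} Yᵏ M with
--       Y = Σ_g δ_g M_g z^{g+1} (decompose a noncrossing partition at the
--       block of its first element; module MomentRecursion);
--   (A), (B) the series A, B of Schröder trees met on resp. off the left
--       branch satisfy polynomial equations whose coefficients are the
--       vertex weights, and the right-hand side of the theorem is a series Rt
--       built from A and B (module SchroederSeries);
--   the inversion argument: (B) makes B the compositional inverse of Y,
--       (A) gives A · (M ∘ B) = z, so Rt · B = z − A, while (N) composed with B
--       gives M ∘ B = 1 + B C′ (M ∘ B); cancelling B (M ∘ B), which has order
--       exactly one, yields Rt = Σ_n Cₙ zⁿ (module InversionArgument).

open import Defs
open import Level using (Level)
open import Data.Nat using (ℕ; _≤_)
open import Algebra.Bundles using (CommutativeRing)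

module PowerSeries {c ℓ} (R : CommutativeRing c ℓ) where

  open import Data.Nat as ℕ using (ℕ; zero; suc; _∸_; _<_; _≤_; z≤n; s≤s)
  open import Data.Nat.Properties using (≤-refl; ≤-trans; n≤1+n; ≤-pred; m≤m+n; m+[n∸m]≡n; m∸n≤m)
  open import Function using (_∘_)
  import Relation.Binary.PropositionalEquality as P
  open CommutativeRing R
  open import Relation.Binary.Reasoning.Setoid setoid
  open import Algebra.Solver.Ring.NaturalCoefficients.Default commutativeSemiring using (solve; _:+_; _:*_; _:=_)

  0*≈ : ∀ {a} x → a ≈ 0# → a * x ≈ 0#
  0*≈ x h = trans (*-congʳ h) (zeroˡ x)

  *0≈ : ∀ {a} x → a ≈ 0# → x * a ≈ 0#
  *0≈ x h = trans (*-congˡ h) (zeroʳ x)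

  Seq : Set c
  Seq = ℕ → Carrier

  infix 4 _≋_
  _≋_ : Seq → Seq → Set ℓ
  x ≋ y = ∀ n → x n ≈ y n

  zeroS : Seq
  zeroS _ = 0#

  one : Seq
  one zero = 1#
  one (suc _) = 0#

  shift : Seq → Seq
  shift x zero = 0#
  shift x (suc n) = x n

  𝐳 : Seq
  𝐳 = shift one

  infixl 6 _⊞_
  _⊞_ : Seq → Seq → Seq
  (x ⊞ y) n = x n + y n

  infixl 7 _·_
  _·_ : Carrier → Seq → Seq
  (a · x) n = a * x n

  infixl 7 _⊛_
  _⊛_ : Seq → Seq → Seq
  (x ⊛ y) zero = x 0 * y 0
  (x ⊛ y) (suc n) = x 0 * y (suc n) + ((x ∘ suc) ⊛ y) n

  pow : Seq → ℕ → Seq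
  pow y zero = one
  pow y (suc k) = y ⊛ pow y k

  ⊛-cong : ∀ {x x' y y'} → x ≋ x' → y ≋ y' → x ⊛ y ≋ x' ⊛ y'
  ⊛-cong hx hy zero = *-cong (hx 0) (hy 0)
  ⊛-cong hx hy (suc n) = +-cong (*-cong (hx 0) (hy (suc n))) (⊛-cong (hx ∘ suc) hy n)

  ⊛-distribʳ : ∀ x x' y → (x ⊞ x') ⊛ y ≋ (x ⊛ y) ⊞ (x' ⊛ y)
  ⊛-distribʳ x x' y zero = distribʳ (y 0) (x 0) (x' 0)
  ⊛-distribʳ x x' y (suc n) = begin
    (x 0 + x' 0) * y (suc n) + ((x ∘ suc ⊞ x' ∘ suc) ⊛ y) n
      ≈⟨ +-cong (distribʳ _ _ _) (⊛-distribʳ (x ∘ suc) (x' ∘ suc) y n) ⟩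
    (x 0 * y (suc n) + x' 0 * y (suc n)) + (((x ∘ suc) ⊛ y) n + ((x' ∘ suc) ⊛ y) n)
      ≈⟨ solve 4 (λ a b c d → ((a :+ b) :+ (c :+ d)) := ((a :+ c) :+ (b :+ d))) refl _ _ _ _ ⟩
    (x 0 * y (suc n) + ((x ∘ suc) ⊛ y) n) + (x' 0 * y (suc n) + ((x' ∘ suc) ⊛ y) n) ∎

  ⊛-scalʳ : ∀ a x y → (a · x) ⊛ y ≋ a · (x ⊛ y)
  ⊛-scalʳ a x y zero = *-assoc _ _ _
  ⊛-scalʳ a x y (suc n) = begin
    a * x 0 * y (suc n) + ((a · (x ∘ suc)) ⊛ y) n  ≈⟨ +-cong (*-assoc _ _ _) (⊛-scalʳ a (x ∘ suc) y n) ⟩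
    a * (x 0 * y (suc n)) + a * ((x ∘ suc) ⊛ y) n  ≈⟨ sym (distribˡ _ _ _) ⟩
    a * (x 0 * y (suc n) + ((x ∘ suc) ⊛ y) n) ∎

  ⊛-zeroʳ : ∀ x y → x ≋ zeroS → x ⊛ y ≋ zeroS
  ⊛-zeroʳ x y h zero = 0*≈ (y 0) (h 0)
  ⊛-zeroʳ x y h (suc n) = trans (+-cong (0*≈ _ (h 0)) (⊛-zeroʳ (x ∘ suc) y (h ∘ suc) n)) (+-identityˡ _)

  one⊛ : ∀ y → one ⊛ y ≋ y
  one⊛ y zero = *-identityˡ _
  one⊛ y (suc n) = trans (+-cong (*-identityˡ _) (⊛-zeroʳ (one ∘ suc) y (λ _ → refl) n)) (+-identityʳ _)

  peelʳ : ∀ x y n → (x ⊛ y) (suc n) ≈ (x ⊛ (y ∘ suc)) n + x (suc n) * y 0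
  peelʳ x y zero = refl
  peelʳ x y (suc n) = begin
    x 0 * y (suc (suc n)) + ((x ∘ suc) ⊛ y) (suc n)
       ≈⟨ +-congˡ (peelʳ (x ∘ suc) y n) ⟩
    x 0 * y (suc (suc n)) + (((x ∘ suc) ⊛ (y ∘ suc)) n + x (suc (suc n)) * y 0)
       ≈⟨ sym (+-assoc _ _ _) ⟩
    (x 0 * y (suc (suc n)) + ((x ∘ suc) ⊛ (y ∘ suc)) n) + x (suc (suc n)) * y 0 ∎

  ⊛-comm : ∀ x y → x ⊛ y ≋ y ⊛ x
  ⊛-comm x y zero = *-comm _ _
  ⊛-comm x y (suc n) = begin
    x 0 * y (suc n) + ((x ∘ suc) ⊛ y) n     ≈⟨ +-cong (*-comm _ _) (⊛-comm (x ∘ suc) y n) ⟩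
    y (suc n) * x 0 + (y ⊛ (x ∘ suc)) n     ≈⟨ +-comm _ _ ⟩
    (y ⊛ (x ∘ suc)) n + y (suc n) * x 0     ≈⟨ sym (peelʳ y x n) ⟩
    (y ⊛ x) (suc n) ∎

  ⊛-distribˡ : ∀ x y y' → x ⊛ (y ⊞ y') ≋ (x ⊛ y) ⊞ (x ⊛ y')
  ⊛-distribˡ x y y' n = trans (⊛-comm x (y ⊞ y') n)
    (trans (⊛-distribʳ y y' x n) (+-cong (⊛-comm y x n) (⊛-comm y' x n)))

  ⊛-scalˡ : ∀ a x y → x ⊛ (a · y) ≋ a · (x ⊛ y)
  ⊛-scalˡ a x y n = trans (⊛-comm x (a · y) n) (trans (⊛-scalʳ a y x n) (*-congˡ (⊛-comm y x n)))

  ⊛-zeroˡ : ∀ x y → y ≋ zeroS → x ⊛ y ≋ zeroS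
  ⊛-zeroˡ x y h n = trans (⊛-comm x y n) (⊛-zeroʳ y x h n)

  ⊛one : ∀ y → y ⊛ one ≋ y
  ⊛one y n = trans (⊛-comm y one n) (one⊛ y n)

  ⊛-assoc : ∀ x y w → (x ⊛ y) ⊛ w ≋ x ⊛ (y ⊛ w)
  ⊛-assoc x y w zero = *-assoc _ _ _
  ⊛-assoc x y w (suc n) = begin
    (x 0 * y 0) * w (suc n) + (((x ⊛ y) ∘ suc) ⊛ w) n
       ≈⟨ +-congˡ (⊛-cong {x = (x ⊛ y) ∘ suc} {x' = (x 0 · (y ∘ suc)) ⊞ ((x ∘ suc) ⊛ y)} (λ _ → refl) (λ _ → refl) n) ⟩
    (x 0 * y 0) * w (suc n) + (((x 0 · (y ∘ suc)) ⊞ ((x ∘ suc) ⊛ y)) ⊛ w) n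
       ≈⟨ +-congˡ (⊛-distribʳ _ _ w n) ⟩
    (x 0 * y 0) * w (suc n) + (((x 0 · (y ∘ suc)) ⊛ w) n + (((x ∘ suc) ⊛ y) ⊛ w) n)
       ≈⟨ +-congˡ (+-cong (⊛-scalʳ (x 0) (y ∘ suc) w n) (⊛-assoc (x ∘ suc) y w n)) ⟩
    (x 0 * y 0) * w (suc n) + (x 0 * ((y ∘ suc) ⊛ w) n + ((x ∘ suc) ⊛ (y ⊛ w)) n)
       ≈⟨ solve 5 (λ a b c d f → ((a :* b) :* c :+ (a :* d :+ f)) := (a :* (b :* c :+ d) :+ f)) refl _ _ _ _ _ ⟩
    x 0 * (y 0 * w (suc n) + ((y ∘ suc) ⊛ w) n) + ((x ∘ suc) ⊛ (y ⊛ w)) n ∎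

  𝐳⊛ : ∀ x → 𝐳 ⊛ x ≋ shift x
  𝐳⊛ x zero = zeroˡ _
  𝐳⊛ x (suc n) = trans (+-congʳ (zeroˡ _)) (trans (+-identityˡ _) (one⊛ x n))

  ⊛𝐳-suc : ∀ x n → (x ⊛ 𝐳) (suc n) ≈ x n
  ⊛𝐳-suc x n = trans (⊛-comm x 𝐳 (suc n)) (𝐳⊛ x (suc n))

  Agree : ℕ → Seq → Seq → Set ℓ
  Agree n x y = ∀ j → j < n → x j ≈ y j

  ⊛-localʳ : ∀ y {x x'} n → Agree (suc n) x x' → (y ⊛ x) n ≈ (y ⊛ x') n
  ⊛-localʳ y zero h = *-congˡ (h 0 (s≤s z≤n))
  ⊛-localʳ y (suc n) h = +-cong (*-congˡ (h (suc n) ≤-refl))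
    (⊛-localʳ (y ∘ suc) n (λ j j< → h j (≤-trans j< (n≤1+n _))))

  ⊛-local : ∀ b {x x'} → b 0 ≈ 0# → ∀ n → Agree n x x' → (b ⊛ x) n ≈ (b ⊛ x') n
  ⊛-local b h0 zero h = trans (0*≈ _ h0) (sym (0*≈ _ h0))
  ⊛-local b h0 (suc n) h = +-cong (trans (0*≈ _ h0) (sym (0*≈ _ h0))) (⊛-localʳ (b ∘ suc) n h)

  agree-⊛ : ∀ n {y y' x x'} → Agree n y y' → Agree n x x' → Agree n (y ⊛ x) (y' ⊛ x')
  agree-⊛ n {y} {y'} {x} {x'} hy hx m m<n = begin
    (y ⊛ x) m   ≈⟨ ⊛-localʳ y m (λ j j<sm → hx j (≤-trans j<sm m<n)) ⟩
    (y ⊛ x') m  ≈⟨ ⊛-comm y x' m ⟩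
    (x' ⊛ y) m  ≈⟨ ⊛-localʳ x' m (λ j j<sm → hy j (≤-trans j<sm m<n)) ⟩
    (x' ⊛ y') m ≈⟨ ⊛-comm x' y' m ⟩
    (y' ⊛ x') m ∎

  pow-cong : ∀ {y y'} → y ≋ y' → ∀ k → pow y k ≋ pow y' k
  pow-cong h zero n = refl
  pow-cong h (suc k) = ⊛-cong h (pow-cong h k)

  agree-pow : ∀ n {y y'} k → Agree n y y' → Agree n (pow y k) (pow y' k)
  agree-pow n zero hy m _ = refl
  agree-pow n (suc k) hy = agree-⊛ n hy (agree-pow n k hy)

  order-⊛ : ∀ p x k → (∀ i → i < k → p i ≈ 0#) → ∀ r → r < k → (p ⊛ x) r ≈ 0#
  order-⊛ p x k h r r<k = trans (⊛-comm p x r)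
    (trans (⊛-localʳ x r (λ j j<r → h j (≤-trans j<r r<k))) (⊛-zeroˡ x zeroS (λ _ → refl) r))

  order-⊛-succ : ∀ x p j → x 0 ≈ 0# → (∀ i → i < j → p i ≈ 0#) → ∀ r → r ≤ j → (x ⊛ p) r ≈ 0#
  order-⊛-succ x p j x0 hp zero _ = 0*≈ _ x0
  order-⊛-succ x p j x0 hp (suc r) r<j = trans (+-cong (0*≈ _ x0)
    (trans (⊛-comm (x ∘ suc) p r) (order-⊛ p (x ∘ suc) j hp r r<j))) (+-identityˡ _)

  pow-order : ∀ b → b 0 ≈ 0# → ∀ k j → j < k → pow b k j ≈ 0#
  pow-order b h0 (suc k) j j<k = trans (⊛-local b h0 j (λ i i<j → pow-order b h0 k i (≤-trans i<j (≤-pred j<k))))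
                                       (⊛-zeroˡ b zeroS (λ _ → refl) j)

  sumTo : ℕ → (ℕ → Carrier) → Carrier
  sumTo zero f = 0#
  sumTo (suc n) f = f 0 + sumTo n (f ∘ suc)

  sumTo-cong : ∀ n {f g} → (∀ k → k < n → f k ≈ g k) → sumTo n f ≈ sumTo n g
  sumTo-cong zero h = refl
  sumTo-cong (suc n) h = +-cong (h 0 (s≤s z≤n)) (sumTo-cong n (λ k k< → h (suc k) (s≤s k<)))

  sumTo-0 : ∀ n {f} → (∀ k → k < n → f k ≈ 0#) → sumTo n f ≈ 0#
  sumTo-0 zero h = refl
  sumTo-0 (suc n) h = trans (+-cong (h 0 (s≤s z≤n)) (sumTo-0 n (λ k k< → h (suc k) (s≤s k<)))) (+-identityˡ _)

  sumTo-+ : ∀ n f g → sumTo n (λ k → f k + g k) ≈ sumTo n f + sumTo n g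
  sumTo-+ zero f g = sym (+-identityˡ _)
  sumTo-+ (suc n) f g = trans (+-congˡ (sumTo-+ n (f ∘ suc) (g ∘ suc)))
    (solve 4 (λ a b c d → ((a :+ b) :+ (c :+ d)) := ((a :+ c) :+ (b :+ d))) refl _ _ _ _)

  sumTo-*ˡ : ∀ n a f → sumTo n (λ k → a * f k) ≈ a * sumTo n f
  sumTo-*ˡ zero a f = sym (zeroʳ a)
  sumTo-*ˡ (suc n) a f = trans (+-congˡ (sumTo-*ˡ n a (f ∘ suc))) (sym (distribˡ _ _ _))

  sumTo-*ʳ : ∀ n a f → sumTo n (λ k → f k * a) ≈ sumTo n f * a
  sumTo-*ʳ n a f = trans (sumTo-cong n (λ k _ → *-comm _ _)) (trans (sumTo-*ˡ n a f) (*-comm _ _))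

  sumTo-last : ∀ n f → sumTo (suc n) f ≈ sumTo n f + f n
  sumTo-last zero f = trans (+-identityʳ _) (sym (+-identityˡ _))
  sumTo-last (suc n) f = trans (+-congˡ (sumTo-last n (f ∘ suc))) (sym (+-assoc _ _ _))

  sumTo-split : ∀ a b f → sumTo (a ℕ.+ b) f ≈ sumTo a f + sumTo b (λ i → f (a ℕ.+ i))
  sumTo-split zero b f = sym (+-identityˡ _)
  sumTo-split (suc a) b f = trans (+-congˡ (sumTo-split a b (f ∘ suc))) (sym (+-assoc _ _ _))

  sumTo-extend : ∀ a n f → a ≤ n → (∀ k → a ≤ k → f k ≈ 0#) → sumTo n f ≈ sumTo a f
  sumTo-extend a n f a≤n h = P.subst (λ t → sumTo t f ≈ sumTo a f) (m+[n∸m]≡n a≤n)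
    (trans (sumTo-split a (n ∸ a) f)
      (trans (+-congˡ (sumTo-0 (n ∸ a) (λ k _ → h (a ℕ.+ k) (m≤m+n a k)))) (+-identityʳ _)))

  sumTo-swap : ∀ n m (f : ℕ → ℕ → Carrier) → sumTo n (λ i → sumTo m (f i)) ≈ sumTo m (λ j → sumTo n (λ i → f i j))
  sumTo-swap zero m f = sym (sumTo-0 m (λ _ _ → refl))
  sumTo-swap (suc n) m f = trans (+-congˡ (sumTo-swap n m (f ∘ suc))) (sym (sumTo-+ m (f 0) (λ j → sumTo n (λ i → f (suc i) j))))

  ⊛-coeff : ∀ x y n → (x ⊛ y) n ≈ sumTo (suc n) (λ i → x i * y (n ∸ i))
  ⊛-coeff x y zero = sym (+-identityʳ _)
  ⊛-coeff x y (suc n) = +-congˡ (⊛-coeff (x ∘ suc) y n)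

  ⊛-sumTo : ∀ x N (g : ℕ → Carrier) (p : ℕ → Seq) n →
    (x ⊛ (λ j → sumTo N (λ k → g k * p k j))) n ≈ sumTo N (λ k → g k * (x ⊛ p k) n)
  ⊛-sumTo x zero g p n = ⊛-zeroˡ x _ (λ _ → refl) n
  ⊛-sumTo x (suc N) g p n = begin
    (x ⊛ (λ j → g 0 * p 0 j + sumTo N (λ k → g (suc k) * p (suc k) j))) n
       ≈⟨ ⊛-distribˡ x (g 0 · p 0) _ n ⟩
    (x ⊛ (g 0 · p 0)) n + (x ⊛ (λ j → sumTo N (λ k → g (suc k) * p (suc k) j))) n
       ≈⟨ +-cong (⊛-scalˡ (g 0) x (p 0) n) (⊛-sumTo x N (g ∘ suc) (p ∘ suc) n) ⟩
    g 0 * (x ⊛ p 0) n + sumTo N (λ k → g (suc k) * (x ⊛ p (suc k)) n) ∎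

  sum-⊛-swap : ∀ n (x g : ℕ → Carrier) (P : ℕ → Seq) → (∀ j m → m < j → P j m ≈ 0#) →
    sumTo (suc n) (λ k → x (suc k) * sumTo (suc (n ∸ k)) (λ j → g j * P j (n ∸ k))) ≈
    sumTo (suc n) (λ j → g j * ((x ∘ suc) ⊛ P j) n)
  sum-⊛-swap n x g P hP = begin
    sumTo (suc n) (λ k → x (suc k) * sumTo (suc (n ∸ k)) (λ j → g j * P j (n ∸ k)))
      ≈⟨ sumTo-cong (suc n) {f = λ k → x (suc k) * sumTo (suc (n ∸ k)) (λ j → g j * P j (n ∸ k))}
           (λ k _ → *-congˡ (sym (sumTo-extend (suc (n ∸ k)) (suc n) (λ j → g j * P j (n ∸ k)) (s≤s (m∸n≤m n k))
                                 (λ j sm≤j → trans (*-congˡ (hP j (n ∸ k) sm≤j)) (zeroʳ _))))) ⟩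
    sumTo (suc n) (λ k → x (suc k) * sumTo (suc n) (λ j → g j * P j (n ∸ k)))
      ≈⟨ sumTo-cong (suc n) (λ k _ → sym (sumTo-*ˡ (suc n) (x (suc k)) (λ j → g j * P j (n ∸ k)))) ⟩
    sumTo (suc n) (λ k → sumTo (suc n) (λ j → x (suc k) * (g j * P j (n ∸ k))))
      ≈⟨ sumTo-swap (suc n) (suc n) (λ k j → x (suc k) * (g j * P j (n ∸ k))) ⟩
    sumTo (suc n) (λ j → sumTo (suc n) (λ k → x (suc k) * (g j * P j (n ∸ k))))
      ≈⟨ sumTo-cong (suc n) (λ j _ → trans (sumTo-cong (suc n) (λ k _ →
            solve 3 (λ a b p → (a :* (b :* p)) := (b :* (a :* p))) refl (x (suc k)) (g j) (P j (n ∸ k))))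
            (sumTo-*ˡ (suc n) (g j) (λ k → x (suc k) * P j (n ∸ k)))) ⟩
    sumTo (suc n) (λ j → g j * sumTo (suc n) (λ k → x (suc k) * P j (n ∸ k)))
      ≈⟨ sumTo-cong (suc n) {f = λ j → g j * sumTo (suc n) (λ k → x (suc k) * P j (n ∸ k))} (λ j _ → *-congˡ (sym (⊛-coeff (x ∘ suc) (P j) n))) ⟩
    sumTo (suc n) (λ j → g j * ((x ∘ suc) ⊛ P j) n) ∎

module ListFolds {c ℓ} (R : CommutativeRing c ℓ) where

  open import Data.Nat as ℕ using (ℕ; zero; suc; _∸_; _<_; _≤_; z≤n; s≤s)
  open import Data.Nat.Properties using (m≤m+n; m+[n∸m]≡n)
  open import Data.Bool using (true; false; if_then_else_)
  open import Data.List using (List; []; _∷_; _++_; map; concatMap; filterᵇ; applyUpTo; upTo)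
  open import Function using (_∘_)
  import Relation.Binary.PropositionalEquality as P
  open CommutativeRing R
  open import Algebra.Solver.Ring.NaturalCoefficients.Default commutativeSemiring using (solve; _:+_; _:=_)
  open Formulas R using (sumR; prodR)
  open PowerSeries R using (sumTo)

  module _ {A : Set} where
    sumMap-++ : ∀ (h : A → Carrier) xs ys → sumR (map h (xs ++ ys)) ≈ sumR (map h xs) + sumR (map h ys)
    sumMap-++ h [] ys = sym (+-identityˡ _)
    sumMap-++ h (x ∷ xs) ys = trans (+-congˡ (sumMap-++ h xs ys)) (sym (+-assoc _ _ _))

    prodMap-++ : ∀ (h : A → Carrier) xs ys → prodR (map h (xs ++ ys)) ≈ prodR (map h xs) * prodR (map h ys)
    prodMap-++ h [] ys = sym (*-identityˡ _)
    prodMap-++ h (x ∷ xs) ys = trans (*-congˡ (prodMap-++ h xs ys)) (sym (*-assoc _ _ _))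

    sumMap-cong : ∀ {h h' : A → Carrier} xs → (∀ x → h x ≈ h' x) → sumR (map h xs) ≈ sumR (map h' xs)
    sumMap-cong [] hyp = refl
    sumMap-cong (x ∷ xs) hyp = +-cong (hyp x) (sumMap-cong xs hyp)

    sumMap-+ : ∀ (h₁ h₂ : A → Carrier) xs → sumR (map (λ x → h₁ x + h₂ x) xs) ≈ sumR (map h₁ xs) + sumR (map h₂ xs)
    sumMap-+ h₁ h₂ [] = sym (+-identityʳ _)
    sumMap-+ h₁ h₂ (x ∷ xs) = trans (+-congˡ (sumMap-+ h₁ h₂ xs))
      (solve 4 (λ a b c d → ((a :+ b) :+ (c :+ d)) := ((a :+ c) :+ (b :+ d))) refl _ _ _ _)

    sumMap-*ˡ : ∀ a (h : A → Carrier) xs → sumR (map (λ x → a * h x) xs) ≈ a * sumR (map h xs)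
    sumMap-*ˡ a h [] = sym (zeroʳ a)
    sumMap-*ˡ a h (x ∷ xs) = trans (+-congˡ (sumMap-*ˡ a h xs)) (sym (distribˡ _ _ _))

    sumMap-*ʳ : ∀ a (h : A → Carrier) xs → sumR (map (λ x → h x * a) xs) ≈ sumR (map h xs) * a
    sumMap-*ʳ a h xs = trans (sumMap-cong xs (λ x → *-comm _ _)) (trans (sumMap-*ˡ a h xs) (*-comm _ _))

    sumMap-0 : ∀ (h : A → Carrier) xs → (∀ x → h x ≈ 0#) → sumR (map h xs) ≈ 0#
    sumMap-0 h [] hyp = refl
    sumMap-0 h (x ∷ xs) hyp = trans (+-cong (hyp x) (sumMap-0 h xs hyp)) (+-identityˡ _)

    sumMap-filter : ∀ (h : A → Carrier) p xs → sumR (map h (filterᵇ p xs)) ≈ sumR (map (λ x → if p x then h x else 0#) xs)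
    sumMap-filter h p [] = refl
    sumMap-filter h p (x ∷ xs) with p x
    ... | true = +-congˡ (sumMap-filter h p xs)
    ... | false = trans (sumMap-filter h p xs) (sym (+-identityˡ _))

    sumMap-applyUpTo : ∀ (h : A → Carrier) (f : ℕ → A) n → sumR (map h (applyUpTo f n)) ≈ sumTo n (h ∘ f)
    sumMap-applyUpTo h f zero = refl
    sumMap-applyUpTo h f (suc n) = +-congˡ (sumMap-applyUpTo h (f ∘ suc) n)

  module _ {A B : Set} where
    sumMap-map : ∀ (h : B → Carrier) (g : A → B) xs → sumR (map h (map g xs)) ≈ sumR (map (h ∘ g) xs)
    sumMap-map h g [] = refl
    sumMap-map h g (x ∷ xs) = +-congˡ (sumMap-map h g xs)

    prodMap-map : ∀ (h : B → Carrier) (g : A → B) xs → prodR (map h (map g xs)) ≈ prodR (map (h ∘ g) xs)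
    prodMap-map h g [] = refl
    prodMap-map h g (x ∷ xs) = *-congˡ (prodMap-map h g xs)

    sumMap-concatMap : ∀ (h : B → Carrier) (g : A → List B) xs →
      sumR (map h (concatMap g xs)) ≈ sumR (map (λ x → sumR (map h (g x))) xs)
    sumMap-concatMap h g [] = refl
    sumMap-concatMap h g (x ∷ xs) = trans (sumMap-++ h (g x) (concatMap g xs)) (+-congˡ (sumMap-concatMap h g xs))

    prodMap-concatMap : ∀ (h : B → Carrier) (g : A → List B) xs →
      prodR (map h (concatMap g xs)) ≈ prodR (map (λ x → prodR (map h (g x))) xs)
    prodMap-concatMap h g [] = refl
    prodMap-concatMap h g (x ∷ xs) = trans (prodMap-++ h (g x) (concatMap g xs)) (*-congˡ (prodMap-concatMap h g xs))

  sumMap-upTo : ∀ (h : ℕ → Carrier) n → sumR (map h (upTo n)) ≈ sumTo n h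
  sumMap-upTo h n = sumMap-applyUpTo h (λ x → x) n

  prodTo : ℕ → (ℕ → Carrier) → Carrier
  prodTo zero f = 1#
  prodTo (suc n) f = f 0 * prodTo n (f ∘ suc)

  prodTo-cong : ∀ n {f g} → (∀ k → k < n → f k ≈ g k) → prodTo n f ≈ prodTo n g
  prodTo-cong zero h = refl
  prodTo-cong (suc n) h = *-cong (h 0 (s≤s z≤n)) (prodTo-cong n (λ k k< → h (suc k) (s≤s k<)))

  prodTo-1 : ∀ n {f} → (∀ k → k < n → f k ≈ 1#) → prodTo n f ≈ 1#
  prodTo-1 zero h = refl
  prodTo-1 (suc n) h = trans (*-cong (h 0 (s≤s z≤n)) (prodTo-1 n (λ k k< → h (suc k) (s≤s k<)))) (*-identityˡ _)

  prodTo-split : ∀ a b f → prodTo (a ℕ.+ b) f ≈ prodTo a f * prodTo b (λ i → f (a ℕ.+ i))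
  prodTo-split zero b f = sym (*-identityˡ _)
  prodTo-split (suc a) b f = trans (*-congˡ (prodTo-split a b (f ∘ suc))) (sym (*-assoc _ _ _))

  prodTo-extend : ∀ a n f → a ≤ n → (∀ k → a ≤ k → f k ≈ 1#) → prodTo n f ≈ prodTo a f
  prodTo-extend a n f a≤n h = trans (reflexive (P.cong (λ m → prodTo m f) (P.sym (m+[n∸m]≡n a≤n))))
    (trans (prodTo-split a (n ∸ a) f) (trans (*-congˡ (prodTo-1 (n ∸ a) (λ k _ → h (a ℕ.+ k) (m≤m+n a k)))) (*-identityʳ _)))

  prodMap-applyUpTo : ∀ {A : Set} (h : A → Carrier) (f : ℕ → A) n → prodR (map h (applyUpTo f n)) ≈ prodTo n (h ∘ f)
  prodMap-applyUpTo h f zero = refl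
  prodMap-applyUpTo h f (suc n) = *-congˡ (prodMap-applyUpTo h (f ∘ suc) n)


-- Composition is defined by Horner's scheme
-- F ∘ b = F₀ + b · ((F ∘ suc) ∘ b), truncated at the wanted coefficient.
module Composition {c ℓ} (R : CommutativeRing c ℓ) where

  open import Data.Nat using (ℕ; zero; suc; _<_)
  open import Data.Nat.Properties using (≤-refl; ≤-trans; n≤1+n; ≤-pred)
  open import Function using (_∘_)
  open CommutativeRing R
  open import Relation.Binary.Reasoning.Setoid setoid
  open import Algebra.Solver.Ring.NaturalCoefficients.Default commutativeSemiring using (solve; _:+_; _:*_; _:=_)
  open import Algebra.Properties.AbelianGroup +-abelianGroup using () renaming (∙-cancelʳ to +-cancelʳ)
  open PowerSeries R

  module ComposeWith (b : Seq) (b0 : b 0 ≈ 0#) where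

    -- Horner's scheme with N steps; its coefficients below N are exact.
    hornerTrunc : ℕ → Seq → Seq
    hornerTrunc zero F = zeroS
    hornerTrunc (suc N) F = (F 0 · one) ⊞ (b ⊛ hornerTrunc N (F ∘ suc))

    comp : Seq → Seq
    comp F n = hornerTrunc (suc n) F n

    hornerTrunc-cong : ∀ N {F G} → F ≋ G → hornerTrunc N F ≋ hornerTrunc N G
    hornerTrunc-cong zero h n = refl
    hornerTrunc-cong (suc N) h n = +-cong (*-congʳ (h 0)) (⊛-cong (λ _ → refl) (hornerTrunc-cong N (h ∘ suc)) n)

    hornerTrunc-linear : ∀ N a F G → hornerTrunc N ((a · F) ⊞ G) ≋ (a · hornerTrunc N F) ⊞ hornerTrunc N G
    hornerTrunc-linear zero a F G n = sym (trans (+-congʳ (zeroʳ a)) (+-identityˡ _))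
    hornerTrunc-linear (suc N) a F G n = begin
      (a * F 0 + G 0) * one n + (b ⊛ hornerTrunc N ((a · (F ∘ suc)) ⊞ (G ∘ suc))) n
         ≈⟨ +-congˡ (⊛-cong (λ _ → refl) (hornerTrunc-linear N a (F ∘ suc) (G ∘ suc)) n) ⟩
      (a * F 0 + G 0) * one n + (b ⊛ ((a · hornerTrunc N (F ∘ suc)) ⊞ hornerTrunc N (G ∘ suc))) n
         ≈⟨ +-congˡ (⊛-distribˡ b _ _ n) ⟩
      (a * F 0 + G 0) * one n + ((b ⊛ (a · hornerTrunc N (F ∘ suc))) n + (b ⊛ hornerTrunc N (G ∘ suc)) n)
         ≈⟨ +-congˡ (+-congʳ (⊛-scalˡ a b _ n)) ⟩
      (a * F 0 + G 0) * one n + (a * (b ⊛ hornerTrunc N (F ∘ suc)) n + (b ⊛ hornerTrunc N (G ∘ suc)) n)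
         ≈⟨ solve 6 (λ a f g en x y → ((a :* f :+ g) :* en :+ (a :* x :+ y)) := (a :* (f :* en :+ x) :+ (g :* en :+ y))) refl _ _ _ _ _ _ ⟩
      a * (F 0 * one n + (b ⊛ hornerTrunc N (F ∘ suc)) n) + (G 0 * one n + (b ⊛ hornerTrunc N (G ∘ suc)) n) ∎

    hornerTrunc-zero : ∀ N {F} → F ≋ zeroS → hornerTrunc N F ≋ zeroS
    hornerTrunc-zero zero h n = refl
    hornerTrunc-zero (suc N) h n = trans (+-cong (0*≈ _ (h 0)) (⊛-zeroˡ b _ (hornerTrunc-zero N (h ∘ suc)) n)) (+-identityˡ _)

    -- Once N > n, the n-th coefficient of the truncation no longer depends
    -- on N (b has order ≥ 1).  The first argument is a bound for induction.
    hornerTrunc-stable : ∀ B n N N' F → n < B → n < N → n < N' → hornerTrunc N F n ≈ hornerTrunc N' F n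
    hornerTrunc-stable (suc B) n (suc N) (suc N') F n<B n<N n<N' = +-congˡ (⊛-local b b0 n (λ j j<n →
      hornerTrunc-stable B j N N' (F ∘ suc) (≤-trans j<n (≤-pred n<B)) (≤-trans j<n (≤-pred n<N)) (≤-trans j<n (≤-pred n<N'))))

    comp-horner : ∀ F → comp F ≋ (F 0 · one) ⊞ (b ⊛ comp (F ∘ suc))
    comp-horner F n = +-congˡ (⊛-local b b0 n (λ j j<n →
      hornerTrunc-stable (suc n) j n (suc j) (F ∘ suc) (≤-trans j<n (n≤1+n _)) j<n ≤-refl))

    comp-cong : ∀ {F G} → F ≋ G → comp F ≋ comp G
    comp-cong h n = hornerTrunc-cong (suc n) h n

    comp-linear : ∀ a F G → comp ((a · F) ⊞ G) ≋ (a · comp F) ⊞ comp G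
    comp-linear a F G n = hornerTrunc-linear (suc n) a F G n

    comp-+ : ∀ F G → comp (F ⊞ G) ≋ comp F ⊞ comp G
    comp-+ F G n = trans (comp-cong {F = F ⊞ G} {G = (1# · F) ⊞ G} (λ m → +-congʳ (sym (*-identityˡ _))) n)
                         (trans (comp-linear 1# F G n) (+-congʳ (*-identityˡ _)))

    comp-zero : ∀ {F} → F ≋ zeroS → comp F ≋ zeroS
    comp-zero h n = hornerTrunc-zero (suc n) h n

    comp-one : comp one ≋ one
    comp-one n = trans (comp-horner one n) (trans (+-congˡ (⊛-zeroˡ b _ (comp-zero (λ _ → refl)) n))
                   (trans (+-identityʳ _) (*-identityˡ _)))

    comp-shift : ∀ F → comp (shift F) ≋ b ⊛ comp F
    comp-shift F n = trans (comp-horner (shift F) n) (trans (+-congʳ (zeroˡ _)) (+-identityˡ _))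

    comp-⊛′ : ∀ B n → n < B → ∀ F G → comp (F ⊛ G) n ≈ (comp F ⊛ comp G) n
    comp-⊛′ (suc B) n n<B F G = begin
      comp (F ⊛ G) n
        ≈⟨ comp-horner (F ⊛ G) n ⟩
      (F 0 * G 0) * one n + (b ⊛ comp ((F ⊛ G) ∘ suc)) n
        ≈⟨ +-congˡ (⊛-cong {x = b} (λ _ → refl) (comp-cong {F = (F ⊛ G) ∘ suc} {G = (F 0 · (G ∘ suc)) ⊞ ((F ∘ suc) ⊛ G)} (λ _ → refl)) n) ⟩
      (F 0 * G 0) * one n + (b ⊛ comp ((F 0 · (G ∘ suc)) ⊞ ((F ∘ suc) ⊛ G))) n
        ≈⟨ +-congˡ (⊛-cong {x = b} (λ _ → refl) (comp-linear (F 0) (G ∘ suc) ((F ∘ suc) ⊛ G)) n) ⟩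
      (F 0 * G 0) * one n + (b ⊛ ((F 0 · comp (G ∘ suc)) ⊞ comp ((F ∘ suc) ⊛ G))) n
        ≈⟨ +-congˡ (⊛-local b b0 n (λ j j<n → +-congˡ (comp-⊛′ B j (≤-trans j<n (≤-pred n<B)) (F ∘ suc) G))) ⟩
      (F 0 * G 0) * one n + (b ⊛ ((F 0 · comp (G ∘ suc)) ⊞ (comp (F ∘ suc) ⊛ comp G))) n
        ≈⟨ +-congˡ (trans (⊛-distribˡ b _ _ n) (+-congʳ (⊛-scalˡ (F 0) b _ n))) ⟩
      (F 0 * G 0) * one n + (F 0 * (b ⊛ comp (G ∘ suc)) n + (b ⊛ (comp (F ∘ suc) ⊛ comp G)) n)
        ≈⟨ solve 5 (λ f g en x y → ((f :* g) :* en :+ (f :* x :+ y)) := (f :* (g :* en :+ x) :+ y)) refl _ _ _ _ _ ⟩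
      F 0 * (G 0 * one n + (b ⊛ comp (G ∘ suc)) n) + (b ⊛ (comp (F ∘ suc) ⊛ comp G)) n
        ≈⟨ +-cong (*-congˡ (sym (comp-horner G n))) (sym (⊛-assoc b _ _ n)) ⟩
      F 0 * comp G n + ((b ⊛ comp (F ∘ suc)) ⊛ comp G) n
        ≈⟨ +-congʳ (*-congˡ (sym (one⊛ (comp G) n))) ⟩
      F 0 * (one ⊛ comp G) n + ((b ⊛ comp (F ∘ suc)) ⊛ comp G) n
        ≈⟨ +-congʳ (sym (⊛-scalʳ (F 0) one (comp G) n)) ⟩
      ((F 0 · one) ⊛ comp G) n + ((b ⊛ comp (F ∘ suc)) ⊛ comp G) n
        ≈⟨ sym (⊛-distribʳ _ _ (comp G) n) ⟩
      (((F 0 · one) ⊞ (b ⊛ comp (F ∘ suc))) ⊛ comp G) n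
        ≈⟨ ⊛-cong (λ m → sym (comp-horner F m)) (λ _ → refl) n ⟩
      (comp F ⊛ comp G) n ∎

    comp-⊛ : ∀ F G → comp (F ⊛ G) ≋ comp F ⊛ comp G
    comp-⊛ F G n = comp-⊛′ (suc n) n ≤-refl F G

    comp-pow : ∀ F k → comp (pow F k) ≋ pow (comp F) k
    comp-pow F zero = comp-one
    comp-pow F (suc k) n = trans (comp-⊛ F (pow F k) n) (⊛-cong (λ _ → refl) (comp-pow F k) n)

    comp-coeff′ : ∀ B n → n < B → ∀ F → comp F n ≈ sumTo (suc n) (λ k → F k * pow b k n)
    comp-coeff′ (suc B) n n<B F = begin
      comp F n  ≈⟨ comp-horner F n ⟩
      F 0 * one n + (b ⊛ comp (F ∘ suc)) n
        ≈⟨ +-congˡ (⊛-local b b0 n (λ j j<n → trans (comp-coeff′ B j (≤-trans j<n (≤-pred n<B)) (F ∘ suc))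
               (sym (sumTo-extend (suc j) n _ j<n (λ k j<k → *0≈ _ (pow-order b b0 k j j<k)))))) ⟩
      F 0 * one n + (b ⊛ (λ j → sumTo n (λ k → F (suc k) * pow b k j))) n
        ≈⟨ +-congˡ (⊛-sumTo b n (F ∘ suc) (pow b) n) ⟩
      F 0 * one n + sumTo n (λ k → F (suc k) * pow b (suc k) n) ∎

    comp-coeff : ∀ F n → comp F n ≈ sumTo (suc n) (λ k → F k * pow b k n)
    comp-coeff F n = comp-coeff′ (suc n) n ≤-refl F

    -- Composition commutes with a series W = Σₖ gₖ Qₖ whose k-th summand has
    -- order ≥ k, so that each coefficient of W is a finite sum.
    comp-series : ∀ W (g : ℕ → Carrier) (Q : ℕ → Seq) → (∀ r → W r ≈ sumTo (suc r) (λ k → g k * Q k r)) →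
                  (∀ k r → r < k → Q k r ≈ 0#) → ∀ n → comp W n ≈ sumTo (suc n) (λ k → g k * comp (Q k) n)
    comp-series W g Q hW hQ n = begin
      comp W n ≈⟨ comp-coeff W n ⟩
      sumTo (suc n) (λ m → W m * pow b m n)
        ≈⟨ sumTo-cong (suc n) {f = λ m → W m * pow b m n} (λ m m<sn → *-congʳ (trans (hW m)
              (sym (sumTo-extend (suc m) (suc n) (λ k → g k * Q k m) m<sn (λ k sm≤k → *0≈ _ (hQ k m sm≤k)))))) ⟩
      sumTo (suc n) (λ m → sumTo (suc n) (λ k → g k * Q k m) * pow b m n)
        ≈⟨ sumTo-cong (suc n) (λ m _ → sym (sumTo-*ʳ (suc n) (pow b m n) (λ k → g k * Q k m))) ⟩
      sumTo (suc n) (λ m → sumTo (suc n) (λ k → g k * Q k m * pow b m n))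
        ≈⟨ sumTo-swap (suc n) (suc n) (λ m k → g k * Q k m * pow b m n) ⟩
      sumTo (suc n) (λ k → sumTo (suc n) (λ m → g k * Q k m * pow b m n))
        ≈⟨ sumTo-cong (suc n) (λ k _ → trans (sumTo-cong (suc n) (λ m _ → *-assoc (g k) (Q k m) (pow b m n))) (sumTo-*ˡ (suc n) (g k) (λ m → Q k m * pow b m n))) ⟩
      sumTo (suc n) (λ k → g k * sumTo (suc n) (λ m → Q k m * pow b m n))
        ≈⟨ sumTo-cong (suc n) {f = λ k → g k * sumTo (suc n) (λ m → Q k m * pow b m n)} (λ k _ → *-congˡ (sym (comp-coeff (Q k) n))) ⟩
      sumTo (suc n) (λ k → g k * comp (Q k) n) ∎

  cancel-order1′ : ∀ U X X' → U 0 ≈ 0# → U 1 ≈ 1# → U ⊛ X ≋ U ⊛ X' → ∀ B n → n < B → X n ≈ X' n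
  cancel-order1′ U X X' u0 u1 h (suc B) n n<B = leading n (λ j j<n → cancel-order1′ U X X' u0 u1 h B j (≤-trans j<n (≤-pred n<B)))
    where
    -- the coefficients of U X are those of (U/z) X, shifted
    tail-eq : ∀ n → ((U ∘ suc) ⊛ X) n ≈ ((U ∘ suc) ⊛ X') n
    tail-eq n = trans (sym (drop (X (suc n)) _)) (trans (h (suc n)) (drop (X' (suc n)) _))
      where drop : ∀ x y → U 0 * x + y ≈ y
            drop x y = trans (+-congʳ (0*≈ x u0)) (+-identityˡ y)
    unit : ∀ x → U 1 * x ≈ x
    unit x = trans (*-congʳ u1) (*-identityˡ x)
    -- (U/z) X has leading coefficient U₁ Xₙ followed by terms with X of index < n
    leading : ∀ n → Agree n X X' → X n ≈ X' n
    leading zero _ = trans (sym (unit _)) (trans (tail-eq 0) (unit _))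
    leading (suc m) ag = trans (sym (unit _)) (trans (+-cancelʳ ((U ∘ suc ∘ suc ⊛ X) m) _ _
      (trans (tail-eq (suc m)) (+-congˡ (sym (⊛-localʳ (U ∘ suc ∘ suc) m ag))))) (unit _))

  cancel-order1 : ∀ U X X' → U 0 ≈ 0# → U 1 ≈ 1# → U ⊛ X ≋ U ⊛ X' → X ≋ X'
  cancel-order1 U X X' u0 u1 h n = cancel-order1′ U X X' u0 u1 h (suc n) n ≤-refl


-- Put Y = Σ_g δ_g M_g z^{g+1} and C′ = Σ_k C_{k+1} z^k, and assume
--   (N) M = 1 + z Σ_k C_{k+1} Yᵏ M          (the moment recursion),
--   (B) b = z − Σ_{k≥2} δ_{k-1} M_{k-1} bᵏ,
--   (A) a = z − Σ_{k≥2} M_{k-1} a b^{k-1},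
--   (R) Rt z = Σ_{k≥1} M_k a b^{k-1} z      (in all degrees n + 1 ≥ 1).
-- Then (B) says Y ∘ b = z, (A) says a · (M ∘ b) = z, (R) says Rt b + a = z,
-- and (N) composed with b gives M ∘ b = 1 + b C′ (M ∘ b).  For U = b (M ∘ b):
--   Rt U = (z − a)(M ∘ b) = z (M ∘ b − 1) = z C′ U,
-- and U is cancellable (U₀ = 0, U₁ = 1), so Rt = z C′, i.e. Rtₙ = Cₙ for n ≥ 1.
module InversionArgument {c ℓ} (R : CommutativeRing c ℓ) where

  open import Data.Nat using (ℕ; zero; suc; _≤_; s≤s; _∸_; _≤ᵇ_)
  open import Data.Nat.Properties using (≤-refl; ≤-trans; n≤1+n; ≤-pred)
  open import Data.Bool using (Bool; true; false; if_then_else_)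
  open import Function using (_∘_)
  open CommutativeRing R
  open import Relation.Binary.Reasoning.Setoid setoid
  open import Algebra.Properties.AbelianGroup +-abelianGroup using () renaming (∙-cancelʳ to +-cancelʳ)
  open PowerSeries R
  open Composition R

  -- An internal vertex with
  -- k ≥ 2 children carries −M_{k-1}, times δ_{k-1} unless it lies on the left
  -- branch (flag true); the root of a prime tree carries just M_{k-1}.
  branchδ : (ℕ → Carrier) → Bool → ℕ → Carrier
  branchδ δ true k = 1#
  branchδ δ false k = δ (k ∸ 1)

  vertexCoeff : (ℕ → Carrier) → (ℕ → Carrier) → Bool → ℕ → Carrier
  vertexCoeff M δ onLeft k = if 2 ≤ᵇ k then - (M (k ∸ 1) * branchδ δ onLeft k) else 0#

  rootCoeff : (ℕ → Carrier) → ℕ → Carrier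
  rootCoeff M k = if 2 ≤ᵇ k then M (k ∸ 1) else 0#

  -- generating series of k subtrees, the first counted by a, the others by b
  firstRest : Seq → Seq → ℕ → Seq
  firstRest a b zero = one
  firstRest a b (suc k) = a ⊛ pow b k

  -- the same followed by one more child that is a leaf
  firstRestLeaf : Seq → Seq → ℕ → Seq
  firstRestLeaf a b zero = 𝐳
  firstRestLeaf a b (suc k) = (a ⊛ pow b k) ⊛ 𝐳

  module Inversion (C δ M a b Rt : ℕ → Carrier)
    (hδ : δ 0 ≈ 1#) (hM0 : M 0 ≈ 1#)
    (hN : ∀ r → M (suc r) ≈ sumTo (suc r) (λ k → C (suc k) * (pow (shift (λ g → δ g * M g)) k ⊛ M) r))
    (ha0 : a 0 ≈ 0#) (hb0 : b 0 ≈ 0#)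
    (hb : ∀ n → b n ≈ 𝐳 n + sumTo (suc n) (λ k → vertexCoeff M δ false k * pow b k n))
    (ha : ∀ n → a n ≈ 𝐳 n + sumTo (suc n) (λ k → vertexCoeff M δ true k * firstRest a b k n))
    (hr : ∀ n → Rt n ≈ sumTo (suc (suc n)) (λ k → rootCoeff M (suc k) * firstRestLeaf a b k (suc n)))
    where

    Y : Seq
    Y = shift (λ g → δ g * M g)

    C′ : Seq
    C′ k = C (suc k)

    open ComposeWith b hb0

    M∘b : Seq
    M∘b = comp M

    -- (B): the terms of Y ∘ b of degree ≥ 2 in b cancel those of (B)
    Y∘b-coeff : ∀ n → sumTo (suc n) (λ k → Y k * pow b k n + vertexCoeff M δ false k * pow b k n) ≈ b n
    Y∘b-coeff zero = trans (+-identityʳ _) (trans (+-cong (zeroˡ _) (zeroˡ _)) (trans (+-identityˡ _) (sym hb0)))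
    Y∘b-coeff (suc m) = begin
      (0# * pow b 0 (suc m) + 0# * pow b 0 (suc m)) + ((δ 0 * M 0 * pow b 1 (suc m) + 0# * pow b 1 (suc m)) + rest)
        ≈⟨ +-cong (trans (+-cong (zeroˡ _) (zeroˡ _)) (+-identityˡ _))
                  (+-cong (trans (+-cong (*-congʳ (trans (*-cong hδ hM0) (*-identityˡ _))) (zeroˡ _)) (trans (+-identityʳ _) (*-identityˡ _)))
                          (sumTo-0 m (λ k _ → cancels k))) ⟩
      0# + (pow b 1 (suc m) + 0#)   ≈⟨ trans (+-identityˡ _) (+-identityʳ _) ⟩
      pow b 1 (suc m)               ≈⟨ ⊛one b (suc m) ⟩
      b (suc m) ∎
      where
      rest = sumTo m (λ k → Y (suc (suc k)) * pow b (suc (suc k)) (suc m) + vertexCoeff M δ false (suc (suc k)) * pow b (suc (suc k)) (suc m))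
      cancels : ∀ k → δ (suc k) * M (suc k) * pow b (suc (suc k)) (suc m) + - (M (suc k) * δ (suc k)) * pow b (suc (suc k)) (suc m) ≈ 0#
      cancels k = trans (sym (distribʳ _ _ _)) (0*≈ _ (trans (+-congˡ (-‿cong (*-comm _ _))) (-‿inverseʳ _)))

    Y∘b≈𝐳 : comp Y ≋ 𝐳
    Y∘b≈𝐳 n = +-cancelʳ Σψ _ _ (begin
      comp Y n + Σψ  ≈⟨ +-congʳ (comp-coeff Y n) ⟩
      sumTo (suc n) (λ k → Y k * pow b k n) + Σψ  ≈⟨ sym (sumTo-+ (suc n) (λ k → Y k * pow b k n) (λ k → vertexCoeff M δ false k * pow b k n)) ⟩
      sumTo (suc n) (λ k → Y k * pow b k n + vertexCoeff M δ false k * pow b k n) ≈⟨ Y∘b-coeff n ⟩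
      b n ≈⟨ hb n ⟩
      𝐳 n + Σψ ∎)
      where Σψ = sumTo (suc n) (λ k → vertexCoeff M δ false k * pow b k n)

    order-a·bᵏ : ∀ j r → r ≤ j → (a ⊛ pow b j) r ≈ 0#
    order-a·bᵏ j r r≤j = order-⊛-succ a (pow b j) j ha0 (λ i i<j → pow-order b hb0 j i i<j) r r≤j

    a·M∘b-coeff : ∀ n → (a ⊛ M∘b) n ≈ sumTo (suc n) (λ k → M k * (a ⊛ pow b k) n)
    a·M∘b-coeff n = trans (⊛-localʳ a n (λ j j<sn → trans (comp-coeff M j)
                        (sym (sumTo-extend (suc j) (suc n) (λ k → M k * pow b k j) j<sn (λ k sj≤k → *0≈ _ (pow-order b hb0 k j sj≤k))))))
                     (⊛-sumTo a (suc n) M (pow b) n)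

    -- (A): the terms M_k a bᵏ with k ≥ 1 cancel those of (A)
    a·M∘b-coeff≈a : ∀ n → sumTo (suc n) (λ k → M k * (a ⊛ pow b k) n) + sumTo (suc n) (λ k → vertexCoeff M δ true k * firstRest a b k n) ≈ a n
    a·M∘b-coeff≈a zero = trans (+-cong (trans (+-identityʳ _) (*0≈ _ (trans (*-congʳ ha0) (zeroˡ _)))) (trans (+-identityʳ _) (zeroˡ _)))
                        (trans (+-identityˡ _) (sym ha0))
    a·M∘b-coeff≈a (suc m) = begin
        (M 0 * T 0 + sumTo (suc m) (λ k → M (suc k) * T (suc k))) + (0# * one (suc m) + (0# * T 0 + Z))
          ≈⟨ +-cong (+-congˡ (trans (sumTo-last m _) (trans (+-congˡ (*0≈ _ (order-a·bᵏ (suc m) (suc m) ≤-refl))) (+-identityʳ _))))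
                    (trans (+-congʳ (zeroˡ _)) (trans (+-identityˡ _) (trans (+-congʳ (zeroˡ _)) (+-identityˡ _)))) ⟩
        (M 0 * T 0 + X) + Z  ≈⟨ +-assoc _ _ _ ⟩
        M 0 * T 0 + (X + Z)  ≈⟨ +-congˡ (trans (sym (sumTo-+ m _ _)) (sumTo-0 m (λ k _ → cancels k))) ⟩
        M 0 * T 0 + 0#       ≈⟨ +-identityʳ _ ⟩
        M 0 * T 0            ≈⟨ trans (*-congʳ hM0) (*-identityˡ _) ⟩
        T 0                  ≈⟨ ⊛one a (suc m) ⟩
        a (suc m) ∎
        where
        T : ℕ → Carrier
        T k = (a ⊛ pow b k) (suc m)
        X = sumTo m (λ k → M (suc k) * T (suc k))
        Z = sumTo m (λ k → vertexCoeff M δ true (suc (suc k)) * T (suc k))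
        cancels : ∀ k → M (suc k) * T (suc k) + - (M (suc k) * 1#) * T (suc k) ≈ 0#
        cancels k = trans (sym (distribʳ _ _ _)) (0*≈ _ (trans (+-congˡ (-‿cong (*-identityʳ _))) (-‿inverseʳ _)))

    a·M∘b≈𝐳 : a ⊛ M∘b ≋ 𝐳
    a·M∘b≈𝐳 n = +-cancelʳ _ _ _ (trans (+-congʳ (a·M∘b-coeff n)) (trans (a·M∘b-coeff≈a n) (ha n)))

    Rt-coeff : ∀ n → Rt n ≈ sumTo (suc n) (λ j → M (suc j) * (a ⊛ pow b j) n)
    Rt-coeff n = trans (hr n) (trans (+-congʳ (zeroˡ _)) (trans (+-identityˡ _)
                 (sumTo-cong (suc n) {f = λ k → M (suc k) * firstRestLeaf a b (suc k) (suc n)} (λ k _ → *-congˡ (⊛𝐳-suc (a ⊛ pow b k) n)))))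

    b·a·bʲ : ∀ j → b ⊛ (a ⊛ pow b j) ≋ a ⊛ pow b (suc j)
    b·a·bʲ j n = trans (sym (⊛-assoc b a (pow b j) n)) (trans (⊛-cong (⊛-comm b a) (λ _ → refl) n) (⊛-assoc a b (pow b j) n))

    -- Rt b + a = Σ_{k≥0} M_k a bᵏ = a (M ∘ b) = z
    Rt·b+a≈𝐳 : ∀ n → (Rt ⊛ b) n + a n ≈ 𝐳 n
    Rt·b+a≈𝐳 n = begin
      (Rt ⊛ b) n + a n ≈⟨ +-congʳ (⊛-comm Rt b n) ⟩
      (b ⊛ Rt) n + a n ≈⟨ +-congʳ (⊛-localʳ b n (λ m m<sn → trans (Rt-coeff m)
            (sym (sumTo-extend (suc m) (suc n) (λ j → M (suc j) * (a ⊛ pow b j) m) m<sn (λ j sm≤j → *0≈ _ (order-a·bᵏ j m (≤-trans (n≤1+n m) sm≤j))))))) ⟩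
      (b ⊛ (λ m → sumTo (suc n) (λ j → M (suc j) * (a ⊛ pow b j) m))) n + a n
        ≈⟨ +-congʳ (⊛-sumTo b (suc n) (M ∘ suc) (λ j → a ⊛ pow b j) n) ⟩
      sumTo (suc n) (λ j → M (suc j) * (b ⊛ (a ⊛ pow b j)) n) + a n
        ≈⟨ +-congʳ (sumTo-cong (suc n) {f = λ j → M (suc j) * (b ⊛ (a ⊛ pow b j)) n} (λ j _ → *-congˡ (b·a·bʲ j n))) ⟩
      sumTo (suc n) (λ j → M (suc j) * (a ⊛ pow b (suc j)) n) + a n
        ≈⟨ +-congʳ (trans (sumTo-last n _) (trans (+-congˡ (*0≈ _ (order-a·bᵏ (suc n) n (n≤1+n n)))) (+-identityʳ _))) ⟩
      sumTo n (λ j → M (suc j) * (a ⊛ pow b (suc j)) n) + a n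
        ≈⟨ +-comm _ _ ⟩
      a n + sumTo n (λ j → M (suc j) * (a ⊛ pow b (suc j)) n)
        ≈⟨ +-congʳ (sym (trans (*-congʳ hM0) (trans (*-identityˡ _) (⊛one a n)))) ⟩
      M 0 * (a ⊛ pow b 0) n + sumTo n (λ j → M (suc j) * (a ⊛ pow b (suc j)) n)
        ≈⟨ sym (a·M∘b-coeff n) ⟩
      (a ⊛ M∘b) n ≈⟨ a·M∘b≈𝐳 n ⟩
      𝐳 n ∎

    -- (N) as an identity of series: M = 1 + z W with W = Σ_k C_{k+1} Yᵏ M
    W : Seq
    W r = sumTo (suc r) (λ k → C (suc k) * (pow Y k ⊛ M) r)

    M-decomp : M ≋ one ⊞ shift W
    M-decomp zero = trans hM0 (sym (+-identityʳ _))
    M-decomp (suc r) = trans (hN r) (sym (+-identityˡ _))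

    𝐳ᵏ⊛ : ∀ k n → k ≤ n → (pow 𝐳 k ⊛ M∘b) n ≈ M∘b (n ∸ k)
    𝐳ᵏ⊛ zero n _ = one⊛ M∘b n
    𝐳ᵏ⊛ (suc k) (suc n) (s≤s k≤n) = trans (⊛-assoc 𝐳 (pow 𝐳 k) M∘b (suc n)) (trans (𝐳⊛ (pow 𝐳 k ⊛ M∘b) (suc n)) (𝐳ᵏ⊛ k n k≤n))

    -- W ∘ b = Σ_k C_{k+1} (Y ∘ b)ᵏ (M ∘ b) = C′ (M ∘ b), using Y ∘ b = z
    W∘b : comp W ≋ C′ ⊛ M∘b
    W∘b n = begin
      comp W n ≈⟨ comp-series W C′ (λ k → pow Y k ⊛ M) (λ r → refl)
                   (λ k r r<k → order-⊛ (pow Y k) M k (λ i i<k → pow-order Y refl k i i<k) r r<k) n ⟩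
      sumTo (suc n) (λ k → C′ k * comp (pow Y k ⊛ M) n)
        ≈⟨ sumTo-cong (suc n) {f = λ k → C′ k * comp (pow Y k ⊛ M) n} (λ k k<sn → *-congˡ (trans (comp-⊛ (pow Y k) M n)
               (trans (⊛-cong (λ m → trans (comp-pow Y k m) (pow-cong Y∘b≈𝐳 k m)) (λ _ → refl) n) (𝐳ᵏ⊛ k n (≤-pred k<sn))))) ⟩
      sumTo (suc n) (λ k → C′ k * M∘b (n ∸ k)) ≈⟨ sym (⊛-coeff C′ M∘b n) ⟩
      (C′ ⊛ M∘b) n ∎

    M∘b-recursion : M∘b ≋ one ⊞ (b ⊛ (C′ ⊛ M∘b))
    M∘b-recursion n = trans (comp-cong M-decomp n) (trans (comp-+ one (shift W) n)
                (+-cong (comp-one n) (trans (comp-shift W n) (⊛-cong (λ _ → refl) W∘b n))))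

    -- U = b (M ∘ b) has U₀ = 0 and U₁ = b₁ (M ∘ b)₀ = 1
    U : Seq
    U = b ⊛ M∘b

    U-0 : U 0 ≈ 0#
    U-0 = 0*≈ _ hb0

    U-1 : U 1 ≈ 1#
    U-1 = trans (+-cong (0*≈ _ hb0) (*-cong b-1 M∘b-0)) (trans (+-identityˡ _) (*-identityˡ _))
      where
      M∘b-0 : M∘b 0 ≈ 1#
      M∘b-0 = trans (comp-horner M 0) (trans (+-cong (trans (*-congʳ hM0) (*-identityˡ _)) (0*≈ _ hb0)) (+-identityʳ _))
      b-1 : b 1 ≈ 1#
      b-1 = trans (hb 1) (trans (+-congˡ (trans (+-cong (zeroˡ _) (trans (+-congʳ (zeroˡ _)) (+-identityˡ _))) (+-identityˡ _))) (+-identityʳ _))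

    𝐳·b·C′·M∘b : 𝐳 ⊛ (b ⊛ (C′ ⊛ M∘b)) ≋ (𝐳 ⊛ C′) ⊛ U
    𝐳·b·C′·M∘b n = trans (⊛-cong (λ _ → refl) (λ m → trans (sym (⊛-assoc b C′ M∘b m)) (trans (⊛-cong (⊛-comm b C′) (λ _ → refl) m) (⊛-assoc C′ b M∘b m))) n)
                    (sym (⊛-assoc 𝐳 C′ U n))

    -- Rt U + z = (Rt b + a)(M ∘ b) = z (M ∘ b) = z + z C′ U
    U·Rt≈U·𝐳C′ : U ⊛ Rt ≋ U ⊛ (𝐳 ⊛ C′)
    U·Rt≈U·𝐳C′ n = trans (⊛-comm U Rt n) (trans (+-cancelʳ (𝐳 n) _ _ (begin
      (Rt ⊛ U) n + 𝐳 n ≈⟨ +-cong (sym (⊛-assoc Rt b M∘b n)) (sym (a·M∘b≈𝐳 n)) ⟩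
      ((Rt ⊛ b) ⊛ M∘b) n + (a ⊛ M∘b) n ≈⟨ sym (⊛-distribʳ (Rt ⊛ b) a M∘b n) ⟩
      (((Rt ⊛ b) ⊞ a) ⊛ M∘b) n ≈⟨ ⊛-cong Rt·b+a≈𝐳 (λ _ → refl) n ⟩
      (𝐳 ⊛ M∘b) n ≈⟨ ⊛-cong (λ _ → refl) M∘b-recursion n ⟩
      (𝐳 ⊛ (one ⊞ (b ⊛ (C′ ⊛ M∘b)))) n ≈⟨ ⊛-distribˡ 𝐳 one _ n ⟩
      (𝐳 ⊛ one) n + (𝐳 ⊛ (b ⊛ (C′ ⊛ M∘b))) n ≈⟨ +-cong (⊛one 𝐳 n) (𝐳·b·C′·M∘b n) ⟩
      𝐳 n + ((𝐳 ⊛ C′) ⊛ U) n ≈⟨ +-comm _ _ ⟩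
      ((𝐳 ⊛ C′) ⊛ U) n + 𝐳 n ∎)) (⊛-comm _ U n))

    Rt≈C : ∀ n → 1 ≤ n → Rt n ≈ C n
    Rt≈C (suc m) _ = trans (cancel-order1 U Rt (𝐳 ⊛ C′) U-0 U-1 U·Rt≈U·𝐳C′ (suc m)) (𝐳⊛ C′ (suc m))


module SchroederSeries {c ℓ} (R : CommutativeRing c ℓ) where

  open import Data.Nat using (ℕ; zero; suc; _+_; _∸_; _<_; _≤_; z≤n; s≤s; _≤ᵇ_; _≡ᵇ_)
  open import Data.Nat.Properties using (≤-refl; ≤-trans; ≤-pred; m∸n≤m)
  open import Data.Bool using (Bool; true; false; if_then_else_)
  open import Data.List using (List; []; _∷_; _++_; map; concatMap; filterᵇ; upTo; length)
  open import Function using (_∘_)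
  import Relation.Binary.PropositionalEquality as P
  open CommutativeRing R renaming (_+_ to _+R_)
  open import Relation.Binary.Reasoning.Setoid setoid
  open import Algebra.Solver.Ring.NaturalCoefficients.Default commutativeSemiring using (solve; _:*_; _:=_)
  open Formulas R using (sumR; prodR; negOnePow)
  open PowerSeries R
  open InversionArgument R
  open ListFolds R
  open import Algebra.Properties.Ring ring using (-‿distribˡ-*; -‿distribʳ-*)

  neg-middle : ∀ a b d → a * (- b) * d ≈ - (a * b * d)
  neg-middle a b d = trans (*-congʳ (sym (-‿distribʳ-* a b))) (sym (-‿distribˡ-* (a * b) d))

  negOnePow-+ : ∀ a b → negOnePow (a + b) ≈ negOnePow a * negOnePow b
  negOnePow-+ zero b = sym (*-identityˡ _)
  negOnePow-+ (suc a) b = trans (-‿cong (negOnePow-+ a b)) (-‿distribˡ-* _ _)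

  length-gapsF : ∀ o cs → length (gapsF o cs) P.≡ length cs ∸ 1
  length-gapsF o [] = P.refl
  length-gapsF o (x ∷ []) = P.refl
  length-gapsF o (x ∷ y ∷ cs) = P.cong suc (length-gapsF (o + leaves x) (y ∷ cs))

  module TreeWeights (M δ : ℕ → Carrier) where

    mutual
      weight : Bool → Tree → Carrier
      weight onLeft leaf = 1#
      weight onLeft (node cs) = - (M (length cs ∸ 1) * branchδ δ onLeft (length cs) * weightF onLeft cs)

      weightF : Bool → List Tree → Carrier
      weightF onLeft [] = 1#
      weightF onLeft (c ∷ cs) = weight onLeft c * weightF false cs

    blockM : List ℕ → Carrier
    blockM B = M (length B)

    degδ : ℕ → Carrier
    degδ d = δ (d ∸ 1)

    mutual
      weight-unfold : ∀ onLeft o t → prodR (map blockM (etaT o t)) * negOnePow (numInternal t) * prodR (map degδ (intPrimeDegs onLeft t)) ≈ weight onLeft t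
      weight-unfold onLeft o leaf = trans (*-identityʳ _) (*-identityˡ _)
      weight-unfold true o (node cs) = begin
        (blockM (gapsF o cs) * EF) * (- NF) * DF  ≈⟨ neg-middle _ _ _ ⟩
        - ((blockM (gapsF o cs) * EF) * NF * DF)  ≈⟨ -‿cong (solve 4 (λ m x y z → ((m :* x) :* y :* z) := (m :* (x :* y :* z))) refl _ _ _ _) ⟩
        - (blockM (gapsF o cs) * (EF * NF * DF))  ≈⟨ -‿cong (*-cong (reflexive (P.cong M (length-gapsF o cs))) (weightF-unfold true o cs)) ⟩
        - (M (length cs ∸ 1) * weightF true cs)   ≈⟨ -‿cong (*-congʳ (sym (*-identityʳ _))) ⟩
        - (M (length cs ∸ 1) * 1# * weightF true cs) ∎
        where
        EF = prodR (map blockM (etaF o cs))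
        NF = negOnePow (numInternalF cs)
        DF = prodR (map degδ (childDegs true cs))
      weight-unfold false o (node cs) = begin
        (blockM (gapsF o cs) * EF) * (- NF) * (degδ (length cs) * DF)  ≈⟨ neg-middle _ _ _ ⟩
        - ((blockM (gapsF o cs) * EF) * NF * (degδ (length cs) * DF))
           ≈⟨ -‿cong (solve 5 (λ m x y d z → ((m :* x) :* y :* (d :* z)) := (m :* d :* (x :* y :* z))) refl _ _ _ _ _) ⟩
        - (blockM (gapsF o cs) * degδ (length cs) * (EF * NF * DF))
           ≈⟨ -‿cong (*-cong (*-congʳ (reflexive (P.cong M (length-gapsF o cs)))) (weightF-unfold false o cs)) ⟩
        - (M (length cs ∸ 1) * δ (length cs ∸ 1) * weightF false cs) ∎
        where
        EF = prodR (map blockM (etaF o cs))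
        NF = negOnePow (numInternalF cs)
        DF = prodR (map degδ (childDegs false cs))

      weightF-unfold : ∀ onLeft o cs → prodR (map blockM (etaF o cs)) * negOnePow (numInternalF cs) * prodR (map degδ (childDegs onLeft cs)) ≈ weightF onLeft cs
      weightF-unfold onLeft o [] = trans (*-identityʳ _) (*-identityˡ _)
      weightF-unfold onLeft o (t ∷ cs) = begin
        prodR (map blockM (etaT o t ++ etaF (o + leaves t) cs)) * negOnePow (numInternal t + numInternalF cs)
          * prodR (map degδ (intPrimeDegs onLeft t ++ childDegs false cs))
          ≈⟨ *-cong (*-cong (prodMap-++ blockM (etaT o t) _) (negOnePow-+ (numInternal t) (numInternalF cs))) (prodMap-++ degδ (intPrimeDegs onLeft t) _) ⟩
        (E1 * E2) * (N1 * N2) * (D1 * D2)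
          ≈⟨ solve 6 (λ a b x y u v → ((a :* b) :* (x :* y) :* (u :* v)) := ((a :* x :* u) :* (b :* y :* v))) refl _ _ _ _ _ _ ⟩
        (E1 * N1 * D1) * (E2 * N2 * D2)
          ≈⟨ *-cong (weight-unfold onLeft o t) (weightF-unfold false (o + leaves t) cs) ⟩
        weight onLeft t * weightF false cs ∎
        where
        E1 = prodR (map blockM (etaT o t))
        E2 = prodR (map blockM (etaF (o + leaves t) cs))
        N1 = negOnePow (numInternal t)
        N2 = negOnePow (numInternalF cs)
        D1 = prodR (map degδ (intPrimeDegs onLeft t))
        D2 = prodR (map degδ (childDegs false cs))

  if-neg : ∀ b A W → (if b then - (A * W) else 0#) ≈ (if b then - A else 0#) * W
  if-neg true A W = -‿distribˡ-* A W
  if-neg false A W = sym (zeroˡ W)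

  module TreeSums (M δ : ℕ → Carrier) where
    open TreeWeights M δ

    treeSum : Bool → ℕ → ℕ → Carrier
    treeSum onLeft f n = sumR (map (weight onLeft) (treesF f n))

    treeSum-0 : ∀ onLeft f → treeSum onLeft f 0 ≈ 0#
    treeSum-0 onLeft zero = refl
    treeSum-0 onLeft (suc f) = refl

    firstRest-pow : ∀ y j → firstRest y y j ≋ pow y j
    firstRest-pow y zero m = refl
    firstRest-pow y (suc j) m = refl

    sum-forests-suc : ∀ f g n (h : List Tree → Carrier) →
      sumR (map h (forestsF f (suc g) (suc n))) ≈
      sumTo (suc n) (λ k → sumR (map (λ t → sumR (map (λ rest → h (t ∷ rest)) (forestsF f g (n ∸ k)))) (treesF f (suc k))))
    sum-forests-suc f g n h = begin
      sumR (map h (concatMap G (map suc (upTo (suc n)))))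
        ≈⟨ sumMap-concatMap h G (map suc (upTo (suc n))) ⟩
      sumR (map (λ k → sumR (map h (G k))) (map suc (upTo (suc n))))
        ≈⟨ sumMap-map (λ k → sumR (map h (G k))) suc (upTo (suc n)) ⟩
      sumR (map (λ k → sumR (map h (G (suc k)))) (upTo (suc n)))
        ≈⟨ sumMap-upTo (λ k → sumR (map h (G (suc k)))) (suc n) ⟩
      sumTo (suc n) (λ k → sumR (map h (G (suc k))))
        ≈⟨ sumTo-cong (suc n) (λ k _ → trans (sumMap-concatMap h (λ t → map (t ∷_) (forestsF f g (n ∸ k))) (treesF f (suc k)))
             (sumMap-cong (treesF f (suc k)) (λ t → sumMap-map h (t ∷_) (forestsF f g (n ∸ k))))) ⟩
      sumTo (suc n) (λ k → sumR (map (λ t → sumR (map (λ rest → h (t ∷ rest)) (forestsF f g (n ∸ k)))) (treesF f (suc k)))) ∎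
      where
      G : ℕ → List (List Tree)
      G k = concatMap (λ t → map (t ∷_) (forestsF f g (suc n ∸ k))) (treesF f k)

    forest-sum : ∀ f g n (φ : ℕ → Carrier) onLeft → n ≤ g →
      sumR (map (λ cs → φ (length cs) * weightF onLeft cs) (forestsF f g n)) ≈ sumTo (suc n) (λ k → φ k * firstRest (treeSum onLeft f) (treeSum false f) k n)
    forest-sum f g zero φ onLeft _ = refl
    forest-sum f (suc g) (suc n) φ onLeft (s≤s n≤g) = begin
      sumR (map (λ cs → φ (length cs) * weightF onLeft cs) (forestsF f (suc g) (suc n)))
        ≈⟨ sum-forests-suc f g n (λ cs → φ (length cs) * weightF onLeft cs) ⟩
      sumTo (suc n) (λ k → sumR (map (λ t → sumR (map (λ rest → φ (suc (length rest)) * (weight onLeft t * weightF false rest)) (Fr k))) (treesF f (suc k))))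
        ≈⟨ sumTo-cong (suc n) (λ k _ → first-tree k) ⟩
      sumTo (suc n) (λ k → x (suc k) * sumTo (suc (n ∸ k)) (λ j → φ (suc j) * pow y j (n ∸ k)))
        ≈⟨ sum-⊛-swap n x (φ ∘ suc) (pow y) (λ j m m<j → pow-order y (treeSum-0 false f) j m m<j) ⟩
      sumTo (suc n) (λ j → φ (suc j) * ((x ∘ suc) ⊛ pow y j) n)
        ≈⟨ sym (trans (+-congʳ (zeroʳ _)) (trans (+-identityˡ _)
               (sumTo-cong (suc n) {f = λ j → φ (suc j) * (x ⊛ pow y j) (suc n)} (λ j _ → *-congˡ (trans (+-congʳ (0*≈ _ (treeSum-0 onLeft f))) (+-identityˡ _)))))) ⟩
      φ 0 * one (suc n) +R sumTo (suc n) (λ j → φ (suc j) * (x ⊛ pow y j) (suc n)) ∎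
      where
      x = treeSum onLeft f
      y = treeSum false f
      Fr : ℕ → List (List Tree)
      Fr k = forestsF f g (n ∸ k)
      first-tree : ∀ k → sumR (map (λ t → sumR (map (λ rest → φ (suc (length rest)) * (weight onLeft t * weightF false rest)) (Fr k))) (treesF f (suc k)))
                         ≈ x (suc k) * sumTo (suc (n ∸ k)) (λ j → φ (suc j) * pow y j (n ∸ k))
      first-tree k = trans (sumMap-cong (treesF f (suc k)) (λ t →
          trans (sumMap-cong (Fr k) (λ rest → solve 3 (λ p a b → (p :* (a :* b)) := (a :* (p :* b))) refl
                                        (φ (suc (length rest))) (weight onLeft t) (weightF false rest)))
                (sumMap-*ˡ (weight onLeft t) (λ rest → φ (suc (length rest)) * weightF false rest) (Fr k))))
        (trans (sumMap-*ʳ _ (weight onLeft) (treesF f (suc k)))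
        (*-congˡ (trans (forest-sum f g (n ∸ k) (φ ∘ suc) false (≤-trans (m∸n≤m n k) n≤g))
                        (sumTo-cong (suc (n ∸ k)) {f = λ j → φ (suc j) * firstRest y y j (n ∸ k)} (λ j _ → *-congˡ (firstRest-pow y j (n ∸ k)))))))

    leafSum : ∀ onLeft n → sumR (map (weight onLeft) (if n ≡ᵇ 1 then leaf ∷ [] else [])) ≈ 𝐳 n
    leafSum onLeft zero = refl
    leafSum onLeft (suc zero) = +-identityʳ _
    leafSum onLeft (suc (suc n)) = refl

    -- The tree series satisfy (A)/(B) one fuel level apart: a tree is a leaf or
    -- a root with k ≥ 2 subtrees.
    treeSum-equation : ∀ onLeft f n → treeSum onLeft (suc f) n ≈ 𝐳 n +R sumTo (suc n) (λ k → vertexCoeff M δ onLeft k * firstRest (treeSum onLeft f) (treeSum false f) k n)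
    treeSum-equation onLeft f n = begin
      treeSum onLeft (suc f) n
        ≈⟨ sumMap-++ (weight onLeft) (if n ≡ᵇ 1 then leaf ∷ [] else []) _ ⟩
      sumR (map (weight onLeft) (if n ≡ᵇ 1 then leaf ∷ [] else [])) +R sumR (map (weight onLeft) (map node (filterᵇ p (forestsF f n n))))
        ≈⟨ +-cong (leafSum onLeft n) (trans (sumMap-map (weight onLeft) node (filterᵇ p (forestsF f n n))) (trans (sumMap-filter (weight onLeft ∘ node) p (forestsF f n n))
             (sumMap-cong (forestsF f n n) (λ cs → if-neg (2 ≤ᵇ length cs) (M (length cs ∸ 1) * branchδ δ onLeft (length cs)) (weightF onLeft cs))))) ⟩
      𝐳 n +R sumR (map (λ cs → vertexCoeff M δ onLeft (length cs) * weightF onLeft cs) (forestsF f n n))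
        ≈⟨ +-congˡ (forest-sum f n n (vertexCoeff M δ onLeft) onLeft ≤-refl) ⟩
      𝐳 n +R sumTo (suc n) (λ k → vertexCoeff M δ onLeft k * firstRest (treeSum onLeft f) (treeSum false f) k n) ∎
      where
      p : List Tree → Bool
      p cs = 2 ≤ᵇ length cs

    isLeaf : Tree → Carrier
    isLeaf leaf = 1#
    isLeaf (node _) = 0#

    emptyCoeff : Carrier → List Tree → Carrier
    emptyCoeff a [] = a
    emptyCoeff a (_ ∷ _) = 0#

    primeWeight : (ℕ → Carrier) → Bool → List Tree → Carrier
    primeWeight φ onLeft cs = if lastIsLeaf cs then φ (length cs) * weightF onLeft cs else 0#

    primeWeight-cons : ∀ (φ : ℕ → Carrier) onLeft t rest →
      primeWeight φ onLeft (t ∷ rest) ≈ isLeaf t * emptyCoeff (φ 1) rest +R weight onLeft t * primeWeight (φ ∘ suc) false rest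
    primeWeight-cons φ onLeft leaf [] = trans (*-congˡ (*-identityˡ _)) (trans (*-identityʳ _)
                           (sym (trans (+-cong (*-identityˡ _) (zeroʳ _)) (+-identityʳ _))))
    primeWeight-cons φ onLeft (node x) [] = sym (trans (+-cong (zeroˡ _) (zeroʳ _)) (+-identityʳ _))
    primeWeight-cons φ onLeft leaf (r ∷ rs) with lastIsLeaf (r ∷ rs)
    ... | true = sym (trans (+-cong (zeroʳ _) refl) (trans (+-identityˡ _)
                    (solve 3 (λ p a b → (a :* (p :* b)) := (p :* (a :* b))) refl _ _ _)))
    ... | false = sym (trans (+-cong (zeroʳ _) (zeroʳ _)) (+-identityˡ _))
    primeWeight-cons φ onLeft (node x) (r ∷ rs) with lastIsLeaf (r ∷ rs)
    ... | true = sym (trans (+-cong (zeroʳ _) refl) (trans (+-identityˡ _)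
                    (solve 3 (λ p a b → (a :* (p :* b)) := (p :* (a :* b))) refl _ _ _)))
    ... | false = sym (trans (+-cong (zeroʳ _) (zeroʳ _)) (+-identityˡ _))

    emptySum : ∀ f g m a → sumR (map (emptyCoeff a) (forestsF f g m)) ≈ a * one m
    emptySum f g zero a = trans (+-identityʳ _) (sym (*-identityʳ _))
    emptySum f zero (suc m) a = sym (zeroʳ a)
    emptySum f (suc g) (suc m) a = trans (sum-forests-suc f g m (emptyCoeff a))
      (trans (sumTo-0 (suc m) (λ k _ → sumMap-0 _ (treesF f (suc k)) (λ t → sumMap-0 _ (forestsF f g (m ∸ k)) (λ _ → refl))))
             (sym (zeroʳ a)))

    leafSum′ : ∀ n → sumR (map isLeaf (if n ≡ᵇ 1 then leaf ∷ [] else [])) ≈ 𝐳 n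
    leafSum′ zero = refl
    leafSum′ (suc zero) = +-identityʳ _
    leafSum′ (suc (suc n)) = refl

    leaf-count : ∀ f m → sumR (map isLeaf (treesF (suc f) m)) ≈ 𝐳 m
    leaf-count f m = trans (sumMap-++ isLeaf (if m ≡ᵇ 1 then leaf ∷ [] else []) _)
      (trans (+-cong (leafSum′ m) (trans (sumMap-map isLeaf node FF) (sumMap-0 (isLeaf ∘ node) FF (λ _ → refl)))) (+-identityʳ _))
      where FF = filterᵇ (λ cs → 2 ≤ᵇ length cs) (forestsF f m m)

    firstRestLeaf-pow : ∀ y j → firstRestLeaf y y j ≋ pow y j ⊛ 𝐳
    firstRestLeaf-pow y zero m = sym (one⊛ 𝐳 m)
    firstRestLeaf-pow y (suc j) m = refl

    prime-forest-sum : ∀ f g n (φ : ℕ → Carrier) onLeft → n ≤ g →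
      sumR (map (primeWeight φ onLeft) (forestsF (suc f) g n)) ≈ sumTo (suc n) (λ k → φ (suc k) * firstRestLeaf (treeSum onLeft (suc f)) (treeSum false (suc f)) k n)
    prime-forest-sum f g zero φ onLeft _ = trans (+-identityʳ _) (sym (trans (+-identityʳ _) (zeroʳ _)))
    prime-forest-sum f (suc g) (suc n) φ onLeft (s≤s n≤g) = begin
      sumR (map (primeWeight φ onLeft) (forestsF (suc f) (suc g) (suc n)))
        ≈⟨ sum-forests-suc (suc f) g n (primeWeight φ onLeft) ⟩
      sumTo (suc n) (λ k → sumR (map (λ t → sumR (map (λ rest → primeWeight φ onLeft (t ∷ rest)) (Fr k))) (treesF (suc f) (suc k))))
        ≈⟨ sumTo-cong (suc n) (λ k _ → first-tree k) ⟩
      sumTo (suc n) (λ k → one k * (φ 1 * one (n ∸ k)) +R x (suc k) * sumTo (suc (n ∸ k)) (λ j → φ (suc (suc j)) * (pow y j ⊛ 𝐳) (n ∸ k)))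
        ≈⟨ sumTo-+ (suc n) (λ k → one k * (φ 1 * one (n ∸ k))) (λ k → x (suc k) * sumTo (suc (n ∸ k)) (λ j → φ (suc (suc j)) * (pow y j ⊛ 𝐳) (n ∸ k))) ⟩
      sumTo (suc n) (λ k → one k * (φ 1 * one (n ∸ k))) +R sumTo (suc n) (λ k → x (suc k) * sumTo (suc (n ∸ k)) (λ j → φ (suc (suc j)) * (pow y j ⊛ 𝐳) (n ∸ k)))
        ≈⟨ +-cong (trans (+-cong (*-identityˡ _) (sumTo-0 n (λ k _ → zeroˡ _))) (+-identityʳ _))
                  (sum-⊛-swap n x (φ ∘ suc ∘ suc) (λ j → pow y j ⊛ 𝐳) (λ j m m<j → order-⊛ (pow y j) 𝐳 j (λ i i<j → pow-order y (treeSum-0 false (suc f)) j i i<j) m m<j)) ⟩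
      φ 1 * one n +R sumTo (suc n) (λ j → φ (suc (suc j)) * ((x ∘ suc) ⊛ (pow y j ⊛ 𝐳)) n)
        ≈⟨ +-congˡ (sumTo-cong (suc n) {f = λ j → φ (suc (suc j)) * ((x ∘ suc) ⊛ (pow y j ⊛ 𝐳)) n} (λ j _ → *-congˡ (sym
              (trans (⊛-assoc x (pow y j) 𝐳 (suc n)) (trans (+-congʳ (0*≈ _ (treeSum-0 onLeft (suc f)))) (+-identityˡ _)))))) ⟩
      φ 1 * 𝐳 (suc n) +R sumTo (suc n) (λ j → φ (suc (suc j)) * ((x ⊛ pow y j) ⊛ 𝐳) (suc n)) ∎
      where
      x = treeSum onLeft (suc f)
      y = treeSum false (suc f)
      Fr : ℕ → List (List Tree)
      Fr k = forestsF (suc f) g (n ∸ k)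
      -- the first tree is the final leaf (only if nothing follows) or factors out
      first-tree : ∀ k → sumR (map (λ t → sumR (map (λ rest → primeWeight φ onLeft (t ∷ rest)) (Fr k))) (treesF (suc f) (suc k))) ≈
         one k * (φ 1 * one (n ∸ k)) +R x (suc k) * sumTo (suc (n ∸ k)) (λ j → φ (suc (suc j)) * (pow y j ⊛ 𝐳) (n ∸ k))
      first-tree k = begin
        sumR (map (λ t → sumR (map (λ rest → primeWeight φ onLeft (t ∷ rest)) (Fr k))) Ts)
          ≈⟨ sumMap-cong Ts (λ t → trans (sumMap-cong (Fr k) (λ rest → primeWeight-cons φ onLeft t rest))
                (trans (sumMap-+ (λ rest → isLeaf t * emptyCoeff (φ 1) rest) (λ rest → weight onLeft t * primeWeight (φ ∘ suc) false rest) (Fr k))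
                       (+-cong (trans (sumMap-*ˡ (isLeaf t) (emptyCoeff (φ 1)) (Fr k)) (*-congˡ (emptySum (suc f) g (n ∸ k) (φ 1))))
                               (trans (sumMap-*ˡ (weight onLeft t) (primeWeight (φ ∘ suc) false) (Fr k))
                                      (*-congˡ (prime-forest-sum f g (n ∸ k) (φ ∘ suc) false (≤-trans (m∸n≤m n k) n≤g))))))) ⟩
        sumR (map (λ t → isLeaf t * (φ 1 * one (n ∸ k)) +R weight onLeft t * RS) Ts)
          ≈⟨ sumMap-+ (λ t → isLeaf t * (φ 1 * one (n ∸ k))) (λ t → weight onLeft t * RS) Ts ⟩
        sumR (map (λ t → isLeaf t * (φ 1 * one (n ∸ k))) Ts) +R sumR (map (λ t → weight onLeft t * RS) Ts)
          ≈⟨ +-cong (trans (sumMap-*ʳ _ isLeaf Ts) (*-congʳ (leaf-count f (suc k)))) (sumMap-*ʳ RS (weight onLeft) Ts) ⟩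
        one k * (φ 1 * one (n ∸ k)) +R x (suc k) * RS
          ≈⟨ +-congˡ (*-congˡ (sumTo-cong (suc (n ∸ k)) {f = λ j → φ (suc (suc j)) * firstRestLeaf y y j (n ∸ k)} (λ j _ → *-congˡ (firstRestLeaf-pow y j (n ∸ k))))) ⟩
        one k * (φ 1 * one (n ∸ k)) +R x (suc k) * sumTo (suc (n ∸ k)) (λ j → φ (suc (suc j)) * (pow y j ⊛ 𝐳) (n ∸ k)) ∎
        where
        Ts = treesF (suc f) (suc k)
        RS = sumTo (suc (n ∸ k)) (λ j → φ (suc (suc j)) * firstRestLeaf y y j (n ∸ k))

    -- The coefficient n of x yʲ only depends on x, y below n (orders ≥ 1), so the
    -- right-hand sides of the tree equations agree when the series do below n.
    agree-headTail : ∀ n x x' y y' j → x 0 ≈ 0# → x' 0 ≈ 0# → y 0 ≈ 0# → y' 0 ≈ 0# → Agree n x x' → Agree n y y' →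
      (x ⊛ pow y (suc j)) n ≈ (x' ⊛ pow y' (suc j)) n
    agree-headTail n x x' y y' j x0 x'0 y0 y'0 hx hy = begin
      (x ⊛ P) n   ≈⟨ ⊛-local x x0 n (agree-pow n (suc j) hy) ⟩
      (x ⊛ P') n  ≈⟨ ⊛-comm x P' n ⟩
      (P' ⊛ x) n  ≈⟨ ⊛-local P' (pow-order y' y'0 (suc j) 0 (s≤s z≤n)) n hx ⟩
      (P' ⊛ x') n ≈⟨ ⊛-comm P' x' n ⟩
      (x' ⊛ P') n ∎
      where P = pow y (suc j)
            P' = pow y' (suc j)

    term-agree : ∀ onLeft n k x y x' y' → x 0 ≈ 0# → x' 0 ≈ 0# → y 0 ≈ 0# → y' 0 ≈ 0# → Agree n x x' → Agree n y y' →
      vertexCoeff M δ onLeft k * firstRest x y k n ≈ vertexCoeff M δ onLeft k * firstRest x' y' k n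
    term-agree onLeft n zero x y x' y' _ _ _ _ _ _ = trans (zeroˡ _) (sym (zeroˡ _))
    term-agree onLeft n (suc zero) x y x' y' _ _ _ _ _ _ = trans (zeroˡ _) (sym (zeroˡ _))
    term-agree onLeft n (suc (suc j)) x y x' y' x0 x'0 y0 y'0 hx hy = *-congˡ (agree-headTail n x x' y y' j x0 x'0 y0 y'0 hx hy)

    terms-agree : ∀ onLeft n x y x' y' → x 0 ≈ 0# → x' 0 ≈ 0# → y 0 ≈ 0# → y' 0 ≈ 0# → Agree n x x' → Agree n y y' →
      sumTo (suc n) (λ k → vertexCoeff M δ onLeft k * firstRest x y k n) ≈ sumTo (suc n) (λ k → vertexCoeff M δ onLeft k * firstRest x' y' k n)
    terms-agree onLeft n x y x' y' x0 x'0 y0 y'0 hx hy = sumTo-cong (suc n) (λ k _ → term-agree onLeft n k x y x' y' x0 x'0 y0 y'0 hx hy)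

    treeSum-stable : ∀ Bd n → n < Bd → ∀ f f' → n < f → n < f' → ∀ onLeft → treeSum onLeft f n ≈ treeSum onLeft f' n
    treeSum-stable (suc Bd) n n<B (suc g) (suc g') n<f n<f' onLeft =
      trans (treeSum-equation onLeft g n) (trans (+-congˡ (terms-agree onLeft n _ _ _ _ (treeSum-0 onLeft g) (treeSum-0 onLeft g') (treeSum-0 false g) (treeSum-0 false g')
              (λ j j<n → ag j j<n onLeft) (λ j j<n → ag j j<n false)))
            (sym (treeSum-equation onLeft g' n)))
      where
      ag : ∀ j → j < n → ∀ onLeft′ → treeSum onLeft′ g j ≈ treeSum onLeft′ g' j
      ag j j<n onLeft′ = treeSum-stable Bd j (≤-trans j<n (≤-pred n<B)) g g' (≤-trans j<n (≤-pred n<f)) (≤-trans j<n (≤-pred n<f')) onLeft′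

    A : Seq
    A n = treeSum true (suc n) n

    B : Seq
    B n = treeSum false (suc n) n

    treeSum-limit : ∀ onLeft f j → j < f → treeSum onLeft f j ≈ treeSum onLeft (suc j) j
    treeSum-limit onLeft f j j<f = treeSum-stable (suc j) j ≤-refl f (suc j) j<f ≤-refl onLeft

    A-equation : ∀ n → A n ≈ 𝐳 n +R sumTo (suc n) (λ k → vertexCoeff M δ true k * firstRest A B k n)
    A-equation n = trans (treeSum-equation true n n) (+-congˡ (terms-agree true n _ _ _ _ (treeSum-0 true n) refl (treeSum-0 false n) refl
             (λ j j<n → treeSum-limit true n j j<n) (λ j j<n → treeSum-limit false n j j<n)))

    B-equation : ∀ n → B n ≈ 𝐳 n +R sumTo (suc n) (λ k → vertexCoeff M δ false k * pow B k n)
    B-equation n = trans (B-equation′ n) (+-congˡ (sumTo-cong (suc n) {f = λ k → vertexCoeff M δ false k * firstRest B B k n} (λ k _ → *-congˡ (firstRest-pow B k n))))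
      where
      B-equation′ : ∀ n → B n ≈ 𝐳 n +R sumTo (suc n) (λ k → vertexCoeff M δ false k * firstRest B B k n)
      B-equation′ n = trans (treeSum-equation false n n) (+-congˡ (terms-agree false n _ _ _ _ (treeSum-0 false n) refl (treeSum-0 false n) refl
             (λ j j<n → treeSum-limit false n j j<n) (λ j j<n → treeSum-limit false n j j<n)))

    firstRestLeaf-limit : ∀ n k → firstRestLeaf (treeSum true (suc n)) (treeSum false (suc n)) k (suc n) ≈ firstRestLeaf A B k (suc n)
    firstRestLeaf-limit n zero = refl
    firstRestLeaf-limit n (suc j) = trans (⊛𝐳-suc (treeSum true (suc n) ⊛ pow (treeSum false (suc n)) j) n) (trans (agree-⊛ (suc n) (λ i i<sn → treeSum-limit true (suc n) i i<sn)
                          (agree-pow (suc n) j (λ i i<sn → treeSum-limit false (suc n) i i<sn)) n ≤-refl) (sym (⊛𝐳-suc (A ⊛ pow B j) n)))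

  if-if : ∀ b ll X A W → X ≈ A * W → (if b then (if ll then X else 0#) else 0#) ≈ (if ll then (if b then A else 0#) * W else 0#)
  if-if true true X A W h = h
  if-if true false X A W h = refl
  if-if false true X A W h = sym (zeroˡ W)
  if-if false false X A W h = refl

  module RhsAsCoefficient (C δ : ℕ → Carrier) where
    M : ℕ → Carrier
    M = Formulas.M R C δ
    open TreeWeights M δ
    open TreeSums M δ

    rhsTerm : Tree → Carrier
    rhsTerm T = prodR (map (λ B → M (length B)) (eta T)) * negOnePow (numInternal T ∸ 1) * Formulas.wtT R C δ T

    -- for a root with children cs: the root block contributes M_{#cs−1}, the
    -- exponent #int(T) − 1 counts the non-root vertices (whose signs weightF
    -- carries), and the root lies on the left branch, so it carries no δ
    rhsTerm-node : ∀ cs → rhsTerm (node cs) ≈ M (length cs ∸ 1) * weightF true cs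
    rhsTerm-node cs = trans (solve 4 (λ m x y z → ((m :* x) :* y :* z) := (m :* (x :* y :* z))) refl _ _ _ _)
                   (*-cong (reflexive (P.cong M (length-gapsF 0 cs))) (weightF-unfold true 0 cs))

    rhs-leaf : ∀ n → sumR (map (λ T → if isPrime T then rhsTerm T else 0#) (if suc n ≡ᵇ 1 then leaf ∷ [] else [])) ≈ 0#
    rhs-leaf zero = +-identityʳ _
    rhs-leaf (suc n) = refl

    -- rhsₙ = Σ_k M_k (A B^{k-1} z)_{n+1}: group prime trees by the forest of
    -- children of the root, whose last tree is a leaf
    rhs-coeff : ∀ n → Formulas.rhs R C δ n ≈ sumTo (suc (suc n)) (λ k → rootCoeff M (suc k) * firstRestLeaf A B k (suc n))
    rhs-coeff n = begin
      sumR (map rhsTerm (filterᵇ isPrime (treesF (suc (suc n)) (suc n))))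
        ≈⟨ sumMap-filter rhsTerm isPrime (treesF (suc (suc n)) (suc n)) ⟩
      sumR (map primeTerm ((if suc n ≡ᵇ 1 then leaf ∷ [] else []) ++ map node rootForests))
        ≈⟨ sumMap-++ primeTerm (if suc n ≡ᵇ 1 then leaf ∷ [] else []) (map node rootForests) ⟩
      sumR (map primeTerm (if suc n ≡ᵇ 1 then leaf ∷ [] else [])) +R sumR (map primeTerm (map node rootForests))
        ≈⟨ trans (+-congʳ (rhs-leaf n)) (+-identityˡ _) ⟩
      sumR (map primeTerm (map node rootForests))
        ≈⟨ trans (sumMap-map primeTerm node rootForests) (sumMap-filter (primeTerm ∘ node) twoOrMore forests) ⟩
      sumR (map (λ cs → if twoOrMore cs then primeTerm (node cs) else 0#) forests)
        ≈⟨ sumMap-cong forests (λ cs → if-if (twoOrMore cs) (lastIsLeaf cs) (rhsTerm (node cs)) (M (length cs ∸ 1)) (weightF true cs) (rhsTerm-node cs)) ⟩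
      sumR (map (primeWeight (rootCoeff M) true) forests)
        ≈⟨ prime-forest-sum n (suc n) (suc n) (rootCoeff M) true ≤-refl ⟩
      sumTo (suc (suc n)) (λ k → rootCoeff M (suc k) * firstRestLeaf (treeSum true (suc n)) (treeSum false (suc n)) k (suc n))
        ≈⟨ sumTo-cong (suc (suc n)) {f = λ k → rootCoeff M (suc k) * firstRestLeaf (treeSum true (suc n)) (treeSum false (suc n)) k (suc n)} (λ k _ → *-congˡ (firstRestLeaf-limit n k)) ⟩
      sumTo (suc (suc n)) (λ k → rootCoeff M (suc k) * firstRestLeaf A B k (suc n)) ∎
      where
      primeTerm : Tree → Carrier
      primeTerm T = if isPrime T then rhsTerm T else 0#
      twoOrMore : List Tree → Bool
      twoOrMore cs = 2 ≤ᵇ length cs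
      forests = forestsF (suc n) (suc n) (suc n)
      rootForests = filterᵇ twoOrMore forests


module NoncrossingRGS where

  open import Data.Nat using (ℕ; zero; suc; _+_; _<_; _≤_; z≤n; s≤s; _≡ᵇ_; _<ᵇ_)
  open import Data.Nat.Properties using (≤-refl; ≤-trans; n≤1+n)
  open import Data.Bool using (Bool; true; false; if_then_else_; _∧_; not; T)
  open import Data.List using (List; []; _∷_; _++_; map; applyUpTo; upTo; length)
  open import Function using (_∘_)
  open import Relation.Binary.PropositionalEquality
  open import Data.Bool.Properties using (T-≡)
  open import Data.Unit using (⊤)
  open import Function.Bundles using (Equivalence)
  open import Data.Empty using (⊥; ⊥-elim)
  open import Relation.Nullary using (¬_)
  open import Data.Product using (Σ; _×_; _,_)
  import Data.Nat.Properties as NP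
  open import Data.Sum using (_⊎_; inj₁; inj₂)
  open import Data.List.Properties using (length-map; length-++)

  allᵇ-applyUpTo : ∀ (p : ℕ → Bool) f n → allᵇ p (applyUpTo f n) ≡ allᵇ (p ∘ f) (upTo n)
  allᵇ-applyUpTo p f zero = refl
  allᵇ-applyUpTo p f (suc n) = cong (p (f 0) ∧_) (trans (allᵇ-applyUpTo p (f ∘ suc) n) (sym (allᵇ-applyUpTo (p ∘ f) suc n)))

  allᵇ-suc : ∀ (p : ℕ → Bool) n → allᵇ p (upTo (suc n)) ≡ p 0 ∧ allᵇ (p ∘ suc) (upTo n)
  allᵇ-suc p n = cong (p 0 ∧_) (allᵇ-applyUpTo p suc n)

  allᵇ-cong : ∀ {p q : ℕ → Bool} n → (∀ i → i < n → p i ≡ q i) → allᵇ p (upTo n) ≡ allᵇ q (upTo n)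
  allᵇ-cong zero h = refl
  allᵇ-cong {p} {q} (suc n) h = trans (allᵇ-suc p n) (trans (cong₂ _∧_ (h 0 (s≤s z≤n)) (allᵇ-cong n (λ i i<n → h (suc i) (s≤s i<n)))) (sym (allᵇ-suc q n)))

  allᵇ-true : ∀ (p : ℕ → Bool) n → (∀ i → i < n → p i ≡ true) → allᵇ p (upTo n) ≡ true
  allᵇ-true p n h = trans (allᵇ-cong n h) (go n)
    where go : ∀ n → allᵇ (λ _ → true) (upTo n) ≡ true
          go zero = refl
          go (suc n) = trans (allᵇ-suc (λ _ → true) n) (go n)

  allᵇ-sound : ∀ (p : ℕ → Bool) n → allᵇ p (upTo n) ≡ true → ∀ i → i < n → p i ≡ true
  allᵇ-sound p (suc n) h zero _ with p 0 | trans (sym (allᵇ-suc p n)) h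
  ... | true | _ = refl
  ... | false | ()
  allᵇ-sound p (suc n) h (suc i) (s≤s i<n) with p 0 | trans (sym (allᵇ-suc p n)) h
  ... | true | h' = allᵇ-sound (p ∘ suc) n h' i i<n
  ... | false | ()

  ∧-false : ∀ a → a ∧ false ≡ false
  ∧-false true = refl
  ∧-false false = refl

  headNC : ℕ → List ℕ → Bool
  headNC x rest = allᵇ (λ j → allᵇ (λ k → allᵇ (λ l →
      not ((j <ᵇ k) ∧ (k <ᵇ l) ∧ (x ≡ᵇ at rest k) ∧ (at rest j ≡ᵇ at rest l) ∧ not (x ≡ᵇ at rest j)))
      ps) ps) ps
    where ps = upTo (length rest)

  noCrossAt : List ℕ → ℕ → ℕ → ℕ → ℕ → Bool
  noCrossAt p i j k l = not ((i <ᵇ j) ∧ (j <ᵇ k) ∧ (k <ᵇ l) ∧ sameBlock p i k ∧ sameBlock p j l ∧ not (sameBlock p i j))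

  L3 L2 L1 : List ℕ → ℕ → ℕ → ℕ → ℕ → Bool
  L3 p N i j k = allᵇ (λ l → noCrossAt p i j k l) (upTo N)
  L2 p N i j _ = allᵇ (λ k → L3 p N i j k) (upTo N)
  L1 p N i _ _ = allᵇ (λ j → L2 p N i j 0) (upTo N)

  noHeadCrossAt : ℕ → List ℕ → ℕ → ℕ → ℕ → Bool
  noHeadCrossAt x rest j k l = not ((j <ᵇ k) ∧ (k <ᵇ l) ∧ (x ≡ᵇ at rest k) ∧ (at rest j ≡ᵇ at rest l) ∧ not (x ≡ᵇ at rest j))

  nc-cons : ∀ x rest → isNoncrossing (x ∷ rest) ≡ headNC x rest ∧ isNoncrossing rest
  nc-cons x rest = trans (allᵇ-suc (λ i → L1 p N i 0 0) n) (cong₂ _∧_ rowA rowB)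
    where
    p = x ∷ rest
    n = length rest
    N = suc n
    rowA : L1 p N 0 0 0 ≡ headNC x rest
    rowA = trans (allᵇ-suc (λ j → L2 p N 0 j 0) n)
      (trans (cong₂ _∧_ (allᵇ-true _ N (λ k _ → allᵇ-true _ N (λ l _ → refl))) refl)
      (allᵇ-cong n (λ j _ → trans (allᵇ-suc (λ k → L3 p N 0 (suc j) k) n)
         (trans (cong₂ _∧_ (allᵇ-true _ N (λ l _ → refl)) refl)
         (allᵇ-cong n (λ k _ → trans (allᵇ-suc (λ l → noCrossAt p 0 (suc j) (suc k) l) n)
            (cong (_∧ allᵇ (λ l → noHeadCrossAt x rest j k l) (upTo n)) (cong not (∧-false (j <ᵇ k))))))))))
    rowB : allᵇ (λ i → L1 p N (suc i) 0 0) (upTo n) ≡ isNoncrossing rest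
    rowB = allᵇ-cong n (λ i _ → trans (allᵇ-suc (λ j → L2 p N (suc i) j 0) n)
      (trans (cong₂ _∧_ (allᵇ-true _ N (λ k _ → allᵇ-true _ N (λ l _ → refl))) refl)
      (allᵇ-cong n (λ j _ → trans (allᵇ-suc (λ k → L3 p N (suc i) (suc j) k) n)
         (trans (cong₂ _∧_ (allᵇ-true _ N (λ l _ → cong not (∧-false (i <ᵇ j)))) refl)
         (allᵇ-cong n (λ k _ → trans (allᵇ-suc (λ l → noCrossAt p (suc i) (suc j) (suc k) l) n)
            (cong (_∧ allᵇ (λ l → noCrossAt rest i j k l) (upTo n)) (cong not (trans (cong ((i <ᵇ j) ∧_) (∧-false (j <ᵇ k))) (∧-false (i <ᵇ j))))))))))))

  T-true : ∀ {b} → b ≡ true → T b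
  T-true = Equivalence.from T-≡

  true-T : ∀ {b} → T b → b ≡ true
  true-T = Equivalence.to T-≡

  ≡ᵇ-sound : ∀ m n → (m ≡ᵇ n) ≡ true → m ≡ n
  ≡ᵇ-sound m n h = NP.≡ᵇ⇒≡ m n (T-true h)

  ≡ᵇ-complete : ∀ m n → m ≡ n → (m ≡ᵇ n) ≡ true
  ≡ᵇ-complete m n h = true-T (NP.≡⇒≡ᵇ m n h)

  ≡ᵇ-false : ∀ m n → ¬ (m ≡ n) → (m ≡ᵇ n) ≡ false
  ≡ᵇ-false m n ne with m ≡ᵇ n in eq
  ... | false = refl
  ... | true = ⊥-elim (ne (≡ᵇ-sound m n eq))

  <ᵇ-sound : ∀ m n → (m <ᵇ n) ≡ true → m < n
  <ᵇ-sound m n h = NP.<ᵇ⇒< m n (T-true h)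

  <ᵇ-complete : ∀ {m n} → m < n → (m <ᵇ n) ≡ true
  <ᵇ-complete h = true-T (NP.<⇒<ᵇ h)

  iff-≡ : ∀ {a b : Bool} → (a ≡ true → b ≡ true) → (b ≡ true → a ≡ true) → a ≡ b
  iff-≡ {false} {false} f g = refl
  iff-≡ {false} {true} f g = g refl
  iff-≡ {true} {false} f g = sym (f refl)
  iff-≡ {true} {true} f g = refl

  HeadNC : ℕ → List ℕ → Set
  HeadNC x rest = ∀ j k l → j < k → k < l → l < length rest → at rest k ≡ x → at rest j ≡ at rest l → at rest j ≡ x

  headNC-sound : ∀ x rest → headNC x rest ≡ true → HeadNC x rest
  headNC-sound x rest h j k l j<k k<l l<n akx ajl = sym (≡ᵇ-sound x (at rest j) sameAsHead)
    where
    n = length rest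
    k<n = NP.<-trans k<l l<n
    j<n = NP.<-trans j<k k<n
    passes : noHeadCrossAt x rest j k l ≡ true
    passes = allᵇ-sound _ n (allᵇ-sound _ n (allᵇ-sound _ n h j j<n) k k<n) l l<n
    fails-unless-head : (x ≡ᵇ at rest j) ≡ false → noHeadCrossAt x rest j k l ≡ false
    fails-unless-head eq rewrite <ᵇ-complete j<k | <ᵇ-complete k<l | ≡ᵇ-complete x (at rest k) (sym akx)
                    | ≡ᵇ-complete (at rest j) (at rest l) ajl | eq = refl
    sameAsHead : (x ≡ᵇ at rest j) ≡ true
    sameAsHead with x ≡ᵇ at rest j in eq
    ... | true = refl
    ... | false with trans (sym passes) (fails-unless-head eq)
    ... | ()

  headNC-complete : ∀ x rest → HeadNC x rest → headNC x rest ≡ true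
  headNC-complete x rest H = allᵇ-true _ n (λ j j<n → allᵇ-true _ n (λ k k<n → allᵇ-true _ n (λ l l<n → go j k l l<n)))
    where
    n = length rest
    go : ∀ j k l → l < n → noHeadCrossAt x rest j k l ≡ true
    go j k l l<n with j <ᵇ k in e1 | k <ᵇ l in e2 | x ≡ᵇ at rest k in e3 | at rest j ≡ᵇ at rest l in e4 | x ≡ᵇ at rest j in e5
    ... | false | _ | _ | _ | _ = refl
    ... | true | false | _ | _ | _ = refl
    ... | true | true | false | _ | _ = refl
    ... | true | true | true | false | _ = refl
    ... | true | true | true | true | true = refl
    ... | true | true | true | true | false = ⊥-elim (false≢true (trans (sym e5) (≡ᵇ-complete x (at rest j)
             (sym (H j k l (<ᵇ-sound j k e1) (<ᵇ-sound k l e2) l<n (sym (≡ᵇ-sound _ _ e3)) (≡ᵇ-sound _ _ e4))))))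
      where false≢true : false ≡ true → ⊥
            false≢true ()

  headNC-false : ∀ x rest j k l → j < k → k < l → l < length rest → at rest k ≡ x → at rest j ≡ at rest l → ¬ (at rest j ≡ x) →
    headNC x rest ≡ false
  headNC-false x rest j k l j<k k<l l<n akx ajl ne with headNC x rest in eq
  ... | false = refl
  ... | true = ⊥-elim (ne (headNC-sound x rest eq j k l j<k k<l l<n akx ajl))

  at-map : ∀ (f : ℕ → ℕ) xs k → k < length xs → at (map f xs) k ≡ f (at xs k)
  at-map f (x ∷ xs) zero _ = refl
  at-map f (x ∷ xs) (suc k) (s≤s k<) = at-map f xs k k<

  at-++ˡ : ∀ xs ys k → k < length xs → at (xs ++ ys) k ≡ at xs k
  at-++ˡ (x ∷ xs) ys zero _ = refl
  at-++ˡ (x ∷ xs) ys (suc k) (s≤s k<) = at-++ˡ xs ys k k<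

  at-++ʳ : ∀ xs ys t → at (xs ++ ys) (length xs + t) ≡ at ys t
  at-++ʳ [] ys t = refl
  at-++ʳ (x ∷ xs) ys t = at-++ʳ xs ys t

  split-pos : ∀ m k → k < m ⊎ Σ ℕ (λ t → k ≡ m + t)
  split-pos zero k = inj₂ (k , refl)
  split-pos (suc m) zero = inj₁ (s≤s z≤n)
  split-pos (suc m) (suc k) with split-pos m k
  ... | inj₁ k<m = inj₁ (s≤s k<m)
  ... | inj₂ (t , eq) = inj₂ (t , cong suc eq)

  Injective : (ℕ → ℕ) → Set
  Injective h = ∀ a b → h a ≡ h b → a ≡ b

  headNC-map : ∀ h → Injective h → ∀ x xs → headNC (h x) (map h xs) ≡ headNC x xs
  headNC-map h inj x xs = iff-≡ (λ eq → headNC-complete x xs (fwd (headNC-sound (h x) (map h xs) eq))) (λ eq → headNC-complete (h x) (map h xs) (bwd (headNC-sound x xs eq)))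
    where
    lm = length-map h xs
    fwd : HeadNC (h x) (map h xs) → HeadNC x xs
    fwd H j k l j<k k<l l<n akx ajl = inj _ _ (trans (sym (at-map h xs j j<n))
        (H j k l j<k k<l (subst (l <_) (sym lm) l<n) (trans (at-map h xs k k<n) (cong h akx))
           (trans (at-map h xs j j<n) (trans (cong h ajl) (sym (at-map h xs l l<n))))))
      where k<n = NP.<-trans k<l l<n
            j<n = NP.<-trans j<k k<n
    bwd : HeadNC x xs → HeadNC (h x) (map h xs)
    bwd H j k l j<k k<l l<n' akx ajl = trans (at-map h xs j j<n) (cong h (H j k l j<k k<l l<n
        (inj _ _ (trans (sym (at-map h xs k k<n)) akx))
        (inj _ _ (trans (sym (at-map h xs j j<n)) (trans ajl (at-map h xs l l<n))))))
      where l<n = subst (l <_) lm l<n'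
            k<n = NP.<-trans k<l l<n
            j<n = NP.<-trans j<k k<n

  nc-map : ∀ h → Injective h → ∀ xs → isNoncrossing (map h xs) ≡ isNoncrossing xs
  nc-map h inj [] = refl
  nc-map h inj (x ∷ xs) = trans (nc-cons (h x) (map h xs)) (trans (cong₂ _∧_ (headNC-map h inj x xs) (nc-map h inj xs)) (sym (nc-cons x xs)))

  NoLab : ℕ → List ℕ → Set
  NoLab x ys = ∀ t → t < length ys → ¬ (at ys t ≡ x)

  Disj : List ℕ → List ℕ → Set
  Disj xs ys = ∀ s t → s < length xs → t < length ys → ¬ (at xs s ≡ at ys t)

  headNC-++ : ∀ x xs ys → NoLab x ys → Disj xs ys → headNC x (xs ++ ys) ≡ headNC x xs
  headNC-++ x xs ys nl dj = iff-≡ (λ eq → headNC-complete x xs (fwd (headNC-sound x (xs ++ ys) eq))) (λ eq → headNC-complete x (xs ++ ys) (bwd (headNC-sound x xs eq)))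
    where
    L = length-++ xs
    fwd : HeadNC x (xs ++ ys) → HeadNC x xs
    fwd H j k l j<k k<l l<n akx ajl = trans (sym (at-++ˡ xs ys j j<n))
        (H j k l j<k k<l (subst (l <_) (sym L) (NP.≤-trans l<n (NP.m≤m+n _ _)))
          (trans (at-++ˡ xs ys k k<n) akx) (trans (at-++ˡ xs ys j j<n) (trans ajl (sym (at-++ˡ xs ys l l<n)))))
      where k<n = NP.<-trans k<l l<n
            j<n = NP.<-trans j<k k<n
    bwd : HeadNC x xs → HeadNC x (xs ++ ys)
    bwd H j k l j<k k<l l<n' akx ajl with split-pos (length xs) k
    ... | inj₂ (t , refl) = ⊥-elim (nl t (NP.+-cancelˡ-< (length xs) _ _ (NP.<-trans k<l (subst (l <_) L l<n')))
                                (trans (sym (at-++ʳ xs ys t)) akx))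
    ... | inj₁ k<m with split-pos (length xs) l
    ...   | inj₁ l<m = trans (at-++ˡ xs ys j j<m) (H j k l j<k k<l l<m (trans (sym (at-++ˡ xs ys k k<m)) akx)
                         (trans (sym (at-++ˡ xs ys j j<m)) (trans ajl (at-++ˡ xs ys l l<m))))
      where j<m = NP.<-trans j<k k<m
    ...   | inj₂ (t , refl) = ⊥-elim (dj j t j<m (NP.+-cancelˡ-< (length xs) _ _ (subst (length xs + t <_) L l<n'))
                               (trans (sym (at-++ˡ xs ys j j<m)) (trans ajl (at-++ʳ xs ys t))))
      where j<m = NP.<-trans j<k k<m

  Disj-cons : ∀ x xs ys → Disj (x ∷ xs) ys → Disj xs ys
  Disj-cons x xs ys d s t s< t< = d (suc s) t (s≤s s<) t<

  Disj-head : ∀ x xs ys → Disj (x ∷ xs) ys → NoLab x ys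
  Disj-head x xs ys d t t< eq = d 0 t (s≤s z≤n) t< (sym eq)

  nc-++ : ∀ xs ys → Disj xs ys → isNoncrossing (xs ++ ys) ≡ isNoncrossing xs ∧ isNoncrossing ys
  nc-++ [] ys d = refl
  nc-++ (x ∷ xs) ys d = trans (nc-cons x (xs ++ ys))
    (trans (cong₂ _∧_ (headNC-++ x xs ys (Disj-head x xs ys d) (Disj-cons x xs ys d)) (nc-++ xs ys (Disj-cons x xs ys d)))
    (trans (sym (∧-assoc (headNC x xs) (isNoncrossing xs) (isNoncrossing ys))) (cong (_∧ isNoncrossing ys) (sym (nc-cons x xs)))))
    where
    ∧-assoc : ∀ a b c → (a ∧ b) ∧ c ≡ a ∧ (b ∧ c)
    ∧-assoc true b c = refl
    ∧-assoc false b c = refl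

  headNC-repeat0 : ∀ z → headNC 0 (0 ∷ z) ≡ headNC 0 z
  headNC-repeat0 z = iff-≡ (λ eq → headNC-complete 0 z (fwd (headNC-sound 0 (0 ∷ z) eq))) (λ eq → headNC-complete 0 (0 ∷ z) (bwd (headNC-sound 0 z eq)))
    where
    fwd : HeadNC 0 (0 ∷ z) → HeadNC 0 z
    fwd H j k l j<k k<l l<n akx ajl = H (suc j) (suc k) (suc l) (s≤s j<k) (s≤s k<l) (s≤s l<n) akx ajl
    bwd : HeadNC 0 z → HeadNC 0 (0 ∷ z)
    bwd H zero k l j<k k<l l<n akx ajl = refl
    bwd H (suc j) (suc k) (suc l) (s≤s j<k) (s≤s k<l) (s≤s l<n) akx ajl = H j k l j<k k<l l<n akx ajl

  headNC-shifted : ∀ g → headNC 0 (map suc g) ≡ true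
  headNC-shifted g = headNC-complete 0 (map suc g) H
    where
    H : HeadNC 0 (map suc g)
    H j k l j<k k<l l<n akx ajl with trans (sym (at-map suc g k (subst (k <_) (length-map suc g) (NP.<-trans k<l l<n)))) akx
    ... | ()

  headNC-skipPrefix : ∀ xs z → NoLab 0 xs → Disj xs (0 ∷ z) → headNC 0 (xs ++ 0 ∷ z) ≡ headNC 0 (0 ∷ z)
  headNC-skipPrefix xs z nl dj = iff-≡ (λ eq → headNC-complete 0 ys (fwd (headNC-sound 0 (xs ++ ys) eq))) (λ eq → headNC-complete 0 (xs ++ ys) (bwd (headNC-sound 0 ys eq)))
    where
    ys = 0 ∷ z
    m = length xs
    L = length-++ xs
    fwd : HeadNC 0 (xs ++ ys) → HeadNC 0 ys
    fwd H j k l j<k k<l l<n akx ajl = trans (sym (at-++ʳ xs ys j))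
      (H (m + j) (m + k) (m + l) (NP.+-monoʳ-< m j<k) (NP.+-monoʳ-< m k<l) (subst (m + l <_) (sym L) (NP.+-monoʳ-< m l<n))
         (trans (at-++ʳ xs ys k) akx) (trans (at-++ʳ xs ys j) (trans ajl (sym (at-++ʳ xs ys l)))))
    bwd : HeadNC 0 ys → HeadNC 0 (xs ++ ys)
    bwd H j k l j<k k<l l<n' akx ajl with split-pos m k
    ... | inj₁ k<m = ⊥-elim (nl k k<m (trans (sym (at-++ˡ xs ys k k<m)) akx))
    ... | inj₂ (tk , refl) with split-pos m l
    ...   | inj₁ l<m = ⊥-elim (NP.<-asym k<l (NP.≤-trans l<m (NP.m≤m+n m tk)))
    ...   | inj₂ (tl , refl) with split-pos m j
    ...     | inj₁ j<m = ⊥-elim (dj j tl j<m (NP.+-cancelˡ-< m _ _ (subst (m + tl <_) L l<n'))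
                             (trans (sym (at-++ˡ xs ys j j<m)) (trans ajl (at-++ʳ xs ys tl))))
    ...     | inj₂ (tj , refl) = trans (at-++ʳ xs ys tj) (H tj tk tl (NP.+-cancelˡ-< m _ _ j<k) (NP.+-cancelˡ-< m _ _ k<l)
                                   (NP.+-cancelˡ-< m _ _ (subst (m + tl <_) L l<n'))
                                   (trans (sym (at-++ʳ xs ys tk)) akx)
                                   (trans (sym (at-++ʳ xs ys tj)) (trans ajl (at-++ʳ xs ys tl))))

  -- relabel c shifts the nonzero labels past the c labels already in use
  relabel : ℕ → ℕ → ℕ
  relabel c zero = zero
  relabel c (suc x) = suc (c + x)

  relabel-injective : ∀ c → Injective (relabel c)
  relabel-injective c zero zero eq = refl
  relabel-injective c zero (suc b) ()
  relabel-injective c (suc a) zero ()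
  relabel-injective c (suc a) (suc b) eq = cong suc (NP.+-cancelˡ-≡ c a b (NP.suc-injective eq))

  suc-inj : Injective suc
  suc-inj a b eq = NP.suc-injective eq

  nc-singletonFirst : ∀ g → isNoncrossing (0 ∷ map suc g) ≡ isNoncrossing g
  nc-singletonFirst g = trans (nc-cons 0 (map suc g)) (cong₂ _∧_ (headNC-shifted g) (nc-map suc suc-inj g))

  -- In 0 (g+1) 0 y′ the string g, shifted, fills the first gap of block 0 and
  -- uses labels disjoint from those of 0 y′.
  disjoint-splitFirst : ∀ g c y → (∀ s → s < length g → at g s < c) → Disj (map suc g) (0 ∷ map (relabel c) y)
  disjoint-splitFirst g c y hg s zero s< t< eq with trans (sym (at-map suc g s (subst (s <_) (length-map suc g) s<))) eq
  ... | ()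
  disjoint-splitFirst g c y hg s (suc t) s< (s≤s t<) eq = go (at y t) (trans (sym (at-map suc g s s<')) (trans eq (at-map (relabel c) y t (subst (t <_) (length-map (relabel c) y) t<))))
    where
    s<' = subst (s <_) (length-map suc g) s<
    go : ∀ a → suc (at g s) ≡ relabel c a → ⊥
    go zero ()
    go (suc b) e' = NP.<-irrefl refl (NP.<-≤-trans (hg s s<') (subst (c ≤_) (sym (NP.suc-injective e')) (NP.m≤m+n c b)))

  nc-splitFirst : ∀ g c y → (∀ s → s < length g → at g s < c) →
    isNoncrossing (0 ∷ (map suc g ++ 0 ∷ map (relabel c) y)) ≡ isNoncrossing g ∧ isNoncrossing (0 ∷ y)
  nc-splitFirst g c y hg = trans (nc-cons 0 (xs ++ ys))
    (trans (cong₂ _∧_ (trans (headNC-skipPrefix xs z nl dj) (headNC-repeat0 z)) (nc-++ xs ys dj))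
    (trans (cong (headNC 0 z ∧_) (cong₂ _∧_ (nc-map suc suc-inj g) (nc-cons 0 z)))
    (trans (bool (headNC 0 z) (isNoncrossing g) (isNoncrossing z))
    (cong (isNoncrossing g ∧_) (trans (sym (nc-cons 0 z)) (nc-map (relabel c) (relabel-injective c) (0 ∷ y)))))))
    where
    xs = map suc g
    z = map (relabel c) y
    ys = 0 ∷ z
    dj = disjoint-splitFirst g c y hg
    nl : NoLab 0 xs
    nl t t< eq with trans (sym (at-map suc g t (subst (t <_) (length-map suc g) t<))) eq
    ... | ()
    bool : ∀ a b d → a ∧ (b ∧ (a ∧ d)) ≡ b ∧ (a ∧ d)
    bool true b d = refl
    bool false true d = refl
    bool false false d = refl

  -- a label of g reused after the second 0 creates a crossing
  nc-crossingFirst : ∀ g y s t → s < length g → t < length y → suc (at g s) ≡ at y t → isNoncrossing (0 ∷ (map suc g ++ 0 ∷ y)) ≡ false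
  nc-crossingFirst g y s t s< t< eq = trans (nc-cons 0 (xs ++ ys)) (cong (_∧ isNoncrossing (xs ++ ys))
     (headNC-false 0 (xs ++ ys) s (m + 0) (m + suc t) s<m0 (NP.+-monoʳ-< m (s≤s z≤n))
        (subst (m + suc t <_) (sym (length-++ xs)) (NP.+-monoʳ-< m (s≤s t<)))
        (at-++ʳ xs ys 0)
        (trans (at-++ˡ xs ys s s<m) (trans (at-map suc g s s<) (trans eq (sym (at-++ʳ xs ys (suc t))))))
        (λ e' → nz (trans (sym (at-map suc g s s<)) (trans (sym (at-++ˡ xs ys s s<m)) e')))))
    where
    xs = map suc g
    ys = 0 ∷ y
    m = length xs
    s<m = subst (s <_) (sym (length-map suc g)) s<
    s<m0 = subst (s <_) (sym (NP.+-identityʳ m)) s<m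
    nz : ∀ {a} → suc a ≡ 0 → ⊥
    nz ()

  -- number of occurrences of a label = size of its block
  count : ℕ → List ℕ → ℕ
  count b p = length (Data.List.filterᵇ (λ x → x ≡ᵇ b) p)

  count-++ : ∀ b xs ys → count b (xs ++ ys) ≡ count b xs + count b ys
  count-++ b [] ys = refl
  count-++ b (x ∷ xs) ys with x ≡ᵇ b
  ... | true = cong suc (count-++ b xs ys)
  ... | false = count-++ b xs ys

  count-map : ∀ h → Injective h → ∀ b xs → count (h b) (map h xs) ≡ count b xs
  count-map h inj b [] = refl
  count-map h inj b (x ∷ xs) with h x ≡ᵇ h b in e1 | x ≡ᵇ b in e2
  ... | true | true = cong suc (count-map h inj b xs)
  ... | false | false = count-map h inj b xs
  ... | true | false = ⊥-elim (bad (trans (sym e2) (≡ᵇ-complete x b (inj x b (≡ᵇ-sound _ _ e1)))))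
    where bad : false ≡ true → ⊥
          bad ()
  ... | false | true = ⊥-elim (bad (trans (sym e1) (≡ᵇ-complete _ _ (cong h (≡ᵇ-sound x b e2)))))
    where bad : false ≡ true → ⊥
          bad ()

  count-absent : ∀ b xs → (∀ t → t < length xs → ¬ (at xs t ≡ b)) → count b xs ≡ 0
  count-absent b [] h = refl
  count-absent b (x ∷ xs) h with x ≡ᵇ b in eq
  ... | true = ⊥-elim (h 0 (s≤s z≤n) (≡ᵇ-sound x b eq))
  ... | false = count-absent b xs (λ t t< → h (suc t) (s≤s t<))

  -- In 0 (g+1) 0 y′ with y′ = relabel c y, the labels 1 … c carry the blocks of g
  -- and the labels c + 1 + i those of 0 y (when g only uses labels < c).
  count-splitFirst : ∀ g c y i → count (suc i) (0 ∷ map suc g ++ 0 ∷ map (relabel c) y) ≡ count i g + count (suc i) (map (relabel c) (0 ∷ y))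
  count-splitFirst g c y i = trans (count-++ (suc i) (map suc g) (0 ∷ map (relabel c) y))
    (cong (_+ count (suc i) (map (relabel c) (0 ∷ y))) (count-map suc suc-inj i g))

  count-bounded : ∀ g c → (∀ s → s < length g → at g s < c) → ∀ k → c ≤ k → count k g ≡ 0
  count-bounded g c hg k c≤k = count-absent k g (λ t t< eq → NP.<-irrefl refl (NP.<-≤-trans (hg t t<) (subst (c ≤_) (sym eq) c≤k)))

  count-splitFirst-old : ∀ g c y i → i < c → count (suc i) (0 ∷ map suc g ++ 0 ∷ map (relabel c) y) ≡ count i g
  count-splitFirst-old g c y i i<c = trans (count-splitFirst g c y i)
    (trans (cong (count i g +_) (count-absent (suc i) (map (relabel c) (0 ∷ y))
              (λ t t< eq → not-old (at (0 ∷ y) t) (trans (sym (at-map (relabel c) (0 ∷ y) t (subst (t <_) (length-map (relabel c) (0 ∷ y)) t<))) eq))))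
           (NP.+-identityʳ _))
    where
    not-old : ∀ a → ¬ (relabel c a ≡ suc i)
    not-old zero ()
    not-old (suc b) eq = NP.<-irrefl refl (NP.<-≤-trans i<c (subst (c ≤_) (NP.suc-injective eq) (NP.m≤m+n c b)))

  count-splitFirst-new : ∀ g c y i → (∀ s → s < length g → at g s < c) →
    count (suc (c + i)) (0 ∷ map suc g ++ 0 ∷ map (relabel c) y) ≡ count (suc i) (0 ∷ y)
  count-splitFirst-new g c y i hg = trans (count-splitFirst g c y (c + i))
    (trans (cong (_+ count (suc (c + i)) (map (relabel c) (0 ∷ y))) (count-bounded g c hg (c + i) (NP.m≤m+n c i)))
           (count-map (relabel c) (relabel-injective c) (suc i) (0 ∷ y)))

  count-beyond : ∀ y → (∀ t → t < length y → at y t ≤ length y) → ∀ k → length y ≤ k → count (suc k) (0 ∷ y) ≡ 0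
  count-beyond y hy k y≤k = count-absent (suc k) (0 ∷ y) absent
    where
    absent : ∀ t → t < length (0 ∷ y) → ¬ (at (0 ∷ y) t ≡ suc k)
    absent zero _ ()
    absent (suc t) (s≤s t<) eq = NP.<-irrefl refl (NP.≤-trans (s≤s (NP.≤-trans (hy t t<) y≤k)) (NP.≤-reflexive (sym eq)))

  -- Restricted growth strings: `grow k a` is the number of labels in use after
  -- appending a when k were in use, and IsRGS k g says g can follow k labels
  -- (each letter is at most the number of labels used so far).
  grow : ℕ → ℕ → ℕ
  grow k a = if a ≡ᵇ k then suc k else k

  labelsUsed : ℕ → List ℕ → ℕ
  labelsUsed k [] = k
  labelsUsed k (a ∷ g) = labelsUsed (grow k a) g

  IsRGS : ℕ → List ℕ → Set
  IsRGS k [] = ⊤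
  IsRGS k (a ∷ g) = (a ≤ k) × IsRGS (grow k a) g

  k≤grow : ∀ k a → k ≤ grow k a
  k≤grow k a with a ≡ᵇ k
  ... | true = n≤1+n k
  ... | false = ≤-refl

  grow≤ : ∀ k a → grow k a ≤ suc k
  grow≤ k a with a ≡ᵇ k
  ... | true = ≤-refl
  ... | false = n≤1+n k

  a<grow : ∀ k a → a ≤ k → a < grow k a
  a<grow k a a≤k with a ≡ᵇ k in eq
  ... | true = s≤s a≤k
  ... | false with NP.m≤n⇒m<n∨m≡n a≤k
  ...   | inj₁ a<k = a<k
  ...   | inj₂ a≡k = ⊥-elim (bad (trans (sym eq) (≡ᵇ-complete a k a≡k)))
    where bad : false ≡ true → ⊥
          bad ()

  k≤labelsUsed : ∀ k g → k ≤ labelsUsed k g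
  k≤labelsUsed k [] = ≤-refl
  k≤labelsUsed k (a ∷ g) = ≤-trans (k≤grow k a) (k≤labelsUsed (grow k a) g)

  labelsUsed≤ : ∀ k g → labelsUsed k g ≤ k + length g
  labelsUsed≤ k [] = subst (k ≤_) (sym (NP.+-identityʳ k)) ≤-refl
  labelsUsed≤ k (a ∷ g) = ≤-trans (labelsUsed≤ (grow k a) g) (subst (grow k a + length g ≤_) (sym (NP.+-suc k (length g))) (NP.+-monoˡ-≤ (length g) (grow≤ k a)))

  rgs-bound : ∀ k g → IsRGS k g → ∀ s → s < length g → at g s < labelsUsed k g
  rgs-bound k (a ∷ g) (a≤k , v) zero _ = NP.<-≤-trans (a<grow k a a≤k) (k≤labelsUsed (grow k a) g)
  rgs-bound k (a ∷ g) (a≤k , v) (suc s) (s≤s s<) = rgs-bound (grow k a) g v s s<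

  rgs-occ : ∀ k g → IsRGS k g → ∀ b → k ≤ b → b < labelsUsed k g → Σ ℕ (λ s → (s < length g) × (at g s ≡ b))
  rgs-occ k [] v b k≤b b<k = ⊥-elim (NP.<-irrefl refl (NP.<-≤-trans b<k k≤b))
  rgs-occ k (a ∷ g) (a≤k , v) b k≤b b<n with a ≡ᵇ k in eq
  ... | false = let (s , s< , eq) = rgs-occ k g v b k≤b b<n in (suc s , s≤s s< , eq)
  ... | true with NP.m≤n⇒m<n∨m≡n k≤b
  ...   | inj₂ k≡b = 0 , s≤s z≤n , trans (≡ᵇ-sound a k eq) k≡b
  ...   | inj₁ k<b = let (s , s< , eq) = rgs-occ (suc k) g v b k<b b<n in (suc s , s≤s s< , eq)


module NoncrossingWeights {c ℓ} (R : CommutativeRing c ℓ) where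

  open import Data.Nat using (ℕ; zero; suc; _+_; _∸_; _<_; _≤_; z≤n; s≤s; _≡ᵇ_; _<ᵇ_; _≤ᵇ_)
  import Data.Nat.Properties as NP
  open import Data.Bool using (Bool; true; false; if_then_else_; _∧_; not)
  open import Data.List using (List; []; _∷_; _++_; map; concatMap; applyUpTo; upTo; length; filterᵇ)
  open import Data.Product using (_×_; _,_)
  import Relation.Binary.PropositionalEquality as P
  open CommutativeRing R renaming (_+_ to _+R_)
  open import Relation.Binary.Reasoning.Setoid setoid
  open Formulas R using (prodR)
  open ListFolds R
  open NoncrossingRGS
  open import Data.List.Properties using (length-map; length-++)

  module ArcWeights (δ : ℕ → Carrier) where

    arcWeight : ℕ × ℕ → Carrier
    arcWeight (i , j) = δ (j ∸ i ∸ 1)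

    wtN : List ℕ → Carrier
    wtN p = prodR (map arcWeight (arcs p))

    isArc : List ℕ → ℕ → ℕ → Bool
    isArc p i j = (i <ᵇ j) ∧ sameBlock p i j ∧ allᵇ (λ k → not ((i <ᵇ k) ∧ (k <ᵇ j) ∧ sameBlock p i k)) (upTo (length p))

    arcFactor : List ℕ → ℕ → ℕ → Carrier
    arcFactor p i j = if isArc p i j then δ (j ∸ i ∸ 1) else 1#

    wtN-prod : ∀ p → wtN p ≈ prodTo (length p) (λ i → prodTo (length p) (λ j → arcFactor p i j))
    wtN-prod p = begin
      prodR (map arcWeight (concatMap G pos))
        ≈⟨ prodMap-concatMap arcWeight G pos ⟩
      prodR (map (λ i → prodR (map arcWeight (G i))) pos)
        ≈⟨ prodMap-applyUpTo (λ i → prodR (map arcWeight (G i))) (λ x → x) (length p) ⟩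
      prodTo (length p) (λ i → prodR (map arcWeight (G i)))
        ≈⟨ prodTo-cong (length p) (λ i _ → trans (prodMap-concatMap arcWeight (H i) pos)
              (trans (prodMap-applyUpTo (λ j → prodR (map arcWeight (H i j))) (λ x → x) (length p))
                     (prodTo-cong (length p) (λ j _ → singleArc i j)))) ⟩
      prodTo (length p) (λ i → prodTo (length p) (λ j → arcFactor p i j)) ∎
      where
      pos = upTo (length p)
      H : ℕ → ℕ → List (ℕ × ℕ)
      H i j = if isArc p i j then (i , j) ∷ [] else []
      G : ℕ → List (ℕ × ℕ)
      G i = concatMap (H i) pos
      singleArc : ∀ i j → prodR (map arcWeight (H i j)) ≈ arcFactor p i j
      singleArc i j with isArc p i j
      ... | true = *-identityʳ _
      ... | false = refl

    -- firstReturn x ys o = δ_{o+j} for the first position j of x in ys (1 if x does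
    -- not occur): the weight of the arc leaving a head x followed by ys.
    firstReturnFactor : ℕ → List ℕ → ℕ → ℕ → Carrier
    firstReturnFactor x ys o j = if (x ≡ᵇ at ys j) ∧ allᵇ (λ k → not ((k <ᵇ j) ∧ (x ≡ᵇ at ys k))) (upTo (length ys)) then δ (o + j) else 1#

    firstReturn : ℕ → List ℕ → ℕ → Carrier
    firstReturn x ys o = prodTo (length ys) (firstReturnFactor x ys o)

    -- the arcs of x ∷ rest are the arc leaving x and the arcs of rest
    wtN-cons : ∀ x rest → wtN (x ∷ rest) ≈ firstReturn x rest 0 * wtN rest
    wtN-cons x rest = begin
      wtN p ≈⟨ wtN-prod p ⟩
      prodTo N (λ i → prodTo N (arcFactor p i))
        ≈⟨ *-cong (trans (*-identityˡ _) (prodTo-cong n (λ j _ → reflexive (P.cong (λ b → if b then δ j else 1#) (c0 j)))))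
                  (prodTo-cong n (λ i _ → trans (*-identityˡ _) (prodTo-cong n (λ j _ →
                       reflexive (P.cong (λ b → if b then δ (j ∸ i ∸ 1) else 1#) (cS i j)))))) ⟩
      firstReturn x rest 0 * prodTo n (λ i → prodTo n (arcFactor rest i))
        ≈⟨ *-congˡ (sym (wtN-prod rest)) ⟩
      firstReturn x rest 0 * wtN rest ∎
      where
      p = x ∷ rest
      n = length rest
      N = suc n
      c0 : ∀ j → isArc p 0 (suc j) P.≡ ((x ≡ᵇ at rest j) ∧ allᵇ (λ k → not ((k <ᵇ j) ∧ (x ≡ᵇ at rest k))) (upTo n))
      c0 j = P.cong ((x ≡ᵇ at rest j) ∧_) (allᵇ-suc (λ k → not ((0 <ᵇ k) ∧ (k <ᵇ suc j) ∧ sameBlock p 0 k)) n)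
      cS : ∀ i j → isArc p (suc i) (suc j) P.≡ isArc rest i j
      cS i j = P.cong (λ b → (i <ᵇ j) ∧ sameBlock rest i j ∧ b) (allᵇ-suc (λ k → not ((suc i <ᵇ k) ∧ (k <ᵇ suc j) ∧ sameBlock p (suc i) k)) n)

    firstReturn-cons : ∀ x y ys o → firstReturn x (y ∷ ys) o ≈ (if x ≡ᵇ y then δ o else firstReturn x ys (suc o))
    firstReturn-cons x y ys o = go (x ≡ᵇ y) P.refl
      where
      n = length ys
      A0 : ∀ j → Bool
      A0 j = allᵇ (λ k → not ((k <ᵇ j) ∧ (x ≡ᵇ at ys k))) (upTo n)
      split0 : ∀ j → allᵇ (λ k → not ((k <ᵇ suc j) ∧ (x ≡ᵇ at (y ∷ ys) k))) (upTo (suc n)) P.≡ (not (x ≡ᵇ y) ∧ A0 j)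
      split0 j = allᵇ-suc (λ k → not ((k <ᵇ suc j) ∧ (x ≡ᵇ at (y ∷ ys) k))) n
      zero-case : ∀ k → not ((k <ᵇ 0) ∧ (x ≡ᵇ at (y ∷ ys) k)) P.≡ true
      zero-case zero = P.refl
      zero-case (suc k) = P.refl
      go : ∀ b → (x ≡ᵇ y) P.≡ b → firstReturn x (y ∷ ys) o ≈ (if x ≡ᵇ y then δ o else firstReturn x ys (suc o))
      go true eq = trans (*-cong (reflexive (P.cong (λ b → if b then δ (o + 0) else 1#)
                                    (P.trans (P.cong₂ _∧_ eq (allᵇ-true _ (suc n) (λ k _ → zero-case k))) P.refl)))
                               (prodTo-1 n (λ j _ → reflexive (P.cong (λ b → if b then δ (o + suc j) else 1#)
                                    (P.trans (P.cong ((x ≡ᵇ at ys j) ∧_) (P.trans (split0 j) (P.cong (λ b → not b ∧ A0 j) eq))) (∧-false _))))))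
                        (trans (*-identityʳ _) (trans (reflexive (P.cong δ (NP.+-identityʳ o)))
                               (reflexive (P.cong (λ b → if b then δ o else firstReturn x ys (suc o)) (P.sym eq)))))
      go false eq = trans (*-cong (reflexive (P.cong (λ b → if b ∧ allᵇ (λ k → not ((k <ᵇ 0) ∧ (x ≡ᵇ at (y ∷ ys) k))) (upTo (suc n)) then δ (o + 0) else 1#) eq)) refl)
                    (trans (*-identityˡ _)
                    (trans (prodTo-cong n (λ j _ → reflexive (P.cong₂ (λ b d → if b then δ d else 1#)
                              (P.cong ((x ≡ᵇ at ys j) ∧_) (P.trans (split0 j) (P.cong (λ b → not b ∧ A0 j) eq))) (NP.+-suc o j))))
                           (reflexive (P.cong (λ b → if b then δ o else firstReturn x ys (suc o)) (P.sym eq)))))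

    ≡ᵇ-inj : ∀ h → Injective h → ∀ a b → (h a ≡ᵇ h b) P.≡ (a ≡ᵇ b)
    ≡ᵇ-inj h inj a b = iff-≡ (λ eq → ≡ᵇ-complete a b (inj a b (≡ᵇ-sound _ _ eq))) (λ eq → ≡ᵇ-complete _ _ (P.cong h (≡ᵇ-sound a b eq)))

    firstReturn-absent : ∀ x ys o → NoLab x ys → firstReturn x ys o ≈ 1#
    firstReturn-absent x [] o nl = refl
    firstReturn-absent x (y ∷ ys) o nl = trans (firstReturn-cons x y ys o)
      (trans (reflexive (P.cong (λ b → if b then δ o else firstReturn x ys (suc o)) (≡ᵇ-false x y (λ eq → nl 0 (s≤s z≤n) (P.sym eq)))))
             (firstReturn-absent x ys (suc o) (λ t t< eq → nl (suc t) (s≤s t<) eq)))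

    firstReturn-map : ∀ h → Injective h → ∀ x xs o → firstReturn (h x) (map h xs) o ≈ firstReturn x xs o
    firstReturn-map h inj x [] o = refl
    firstReturn-map h inj x (y ∷ ys) o = trans (firstReturn-cons (h x) (h y) (map h ys) o)
      (trans (reflexive (P.cong (λ b → if b then δ o else firstReturn (h x) (map h ys) (suc o)) (≡ᵇ-inj h inj x y)))
      (trans (ifc (x ≡ᵇ y)) (sym (firstReturn-cons x y ys o))))
      where
      ifc : ∀ b → (if b then δ o else firstReturn (h x) (map h ys) (suc o)) ≈ (if b then δ o else firstReturn x ys (suc o))
      ifc true = refl
      ifc false = firstReturn-map h inj x ys (suc o)

    firstReturn-++ : ∀ x xs ys o → NoLab x ys → firstReturn x (xs ++ ys) o ≈ firstReturn x xs o
    firstReturn-++ x [] ys o nl = firstReturn-absent x ys o nl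
    firstReturn-++ x (y ∷ xs) ys o nl = trans (firstReturn-cons x y (xs ++ ys) o) (trans (ifc (x ≡ᵇ y)) (sym (firstReturn-cons x y xs o)))
      where
      ifc : ∀ b → (if b then δ o else firstReturn x (xs ++ ys) (suc o)) ≈ (if b then δ o else firstReturn x xs (suc o))
      ifc true = refl
      ifc false = firstReturn-++ x xs ys (suc o) nl

    firstReturn-splitFirst : ∀ g z o → firstReturn 0 (map suc g ++ 0 ∷ z) o ≈ δ (o + length g)
    firstReturn-splitFirst [] z o = trans (firstReturn-cons 0 0 z o) (reflexive (P.cong δ (P.sym (NP.+-identityʳ o))))
    firstReturn-splitFirst (a ∷ g) z o = trans (firstReturn-cons 0 (suc a) (map suc g ++ 0 ∷ z) o)
      (trans (firstReturn-splitFirst g z (suc o)) (reflexive (P.cong δ (P.sym (NP.+-suc o (length g))))))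

    wtN-map : ∀ h → Injective h → ∀ xs → wtN (map h xs) ≈ wtN xs
    wtN-map h inj [] = refl
    wtN-map h inj (x ∷ xs) = trans (wtN-cons (h x) (map h xs)) (trans (*-cong (firstReturn-map h inj x xs 0) (wtN-map h inj xs)) (sym (wtN-cons x xs)))

    wtN-++ : ∀ xs ys → Disj xs ys → wtN (xs ++ ys) ≈ wtN xs * wtN ys
    wtN-++ [] ys d = sym (*-identityˡ _)
    wtN-++ (x ∷ xs) ys d = trans (wtN-cons x (xs ++ ys))
      (trans (*-cong (firstReturn-++ x xs ys 0 (Disj-head x xs ys d)) (wtN-++ xs ys (Disj-cons x xs ys d)))
      (trans (sym (*-assoc _ _ _)) (*-congʳ (sym (wtN-cons x xs)))))

    wtN-singletonFirst : ∀ g → wtN (0 ∷ map suc g) ≈ wtN g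
    wtN-singletonFirst g = trans (wtN-cons 0 (map suc g)) (trans (*-cong (firstReturn-absent 0 (map suc g) 0 nl0) (wtN-map suc suc-inj g)) (*-identityˡ _))
      where
      nl0 : NoLab 0 (map suc g)
      nl0 t t< eq with P.trans (P.sym (at-map suc g t (P.subst (t <_) (length-map suc g) t<))) eq
      ... | ()

    wtN-splitFirst : ∀ g c y → (∀ s → s < length g → at g s < c) →
      wtN (0 ∷ (map suc g ++ 0 ∷ map (relabel c) y)) ≈ δ (length g) * (wtN g * wtN (0 ∷ y))
    wtN-splitFirst g c y hg = trans (wtN-cons 0 (map suc g ++ 0 ∷ map (relabel c) y))
      (*-cong (firstReturn-splitFirst g (map (relabel c) y) 0)
        (trans (wtN-++ (map suc g) (0 ∷ map (relabel c) y) (disjoint-splitFirst g c y hg))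
               (*-cong (wtN-map suc suc-inj g) (wtN-map (relabel c) (relabel-injective c) (0 ∷ y)))))

  module BlockProducts (C : ℕ → Carrier) where

    -- C on nonempty blocks, 1 on labels that do not occur
    blockC : ℕ → Carrier
    blockC zero = 1#
    blockC (suc k) = C (suc k)

    filter-nonempty : ∀ xs → prodR (map C (filterᵇ (λ s → 1 ≤ᵇ s) xs)) ≈ prodR (map blockC xs)
    filter-nonempty [] = refl
    filter-nonempty (zero ∷ xs) = trans (filter-nonempty xs) (sym (*-identityˡ _))
    filter-nonempty (suc k ∷ xs) = *-congˡ (filter-nonempty xs)

    blocksAfterFirst : List ℕ → Carrier
    blocksAfterFirst y = prodR (map C (filterᵇ (λ s → 1 ≤ᵇ s) (map (λ b → count b (0 ∷ y)) (applyUpTo suc (length y)))))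

    blocksAfterFirst-prod : ∀ y → blocksAfterFirst y ≈ prodTo (length y) (λ i → blockC (count (suc i) (0 ∷ y)))
    blocksAfterFirst-prod y = trans (filter-nonempty (map (λ b → count b (0 ∷ y)) (applyUpTo suc (length y)))) (trans (prodMap-map blockC (λ b → count b (0 ∷ y)) (applyUpTo suc (length y))) (prodMap-applyUpTo (λ b → blockC (count b (0 ∷ y))) suc (length y)))

    blockSizes-prod : ∀ g → prodR (map C (blockSizes g)) ≈ prodTo (length g) (λ b → blockC (count b g))
    blockSizes-prod g = trans (filter-nonempty (map (λ b → count b g) (upTo (length g)))) (trans (prodMap-map blockC (λ b → count b g) (upTo (length g))) (prodMap-applyUpTo (λ b → blockC (count b g)) (λ x → x) (length g)))

    blocks-singletonFirst : ∀ g → blocksAfterFirst (map suc g) ≈ prodR (map C (blockSizes g))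
    blocks-singletonFirst g = trans (blocksAfterFirst-prod (map suc g))
      (trans (reflexive (P.cong (λ m → prodTo m (λ i → blockC (count (suc i) (0 ∷ map suc g)))) (length-map suc g)))
      (trans (prodTo-cong (length g) (λ i _ → reflexive (P.cong blockC (count-map suc suc-inj i g))))
             (sym (blockSizes-prod g))))

    blocks-splitFirst : ∀ g c y → (∀ s → s < length g → at g s < c) → c ≤ length g → (∀ t → t < length y → at y t ≤ length y) →
      blocksAfterFirst (map suc g ++ 0 ∷ map (relabel c) y) ≈ prodR (map C (blockSizes g)) * blocksAfterFirst y
    blocks-splitFirst g c y hg c≤ hy = begin
      blocksAfterFirst w ≈⟨ blocksAfterFirst-prod w ⟩
      prodTo (length w) (λ i → blockC (count (suc i) (0 ∷ w)))
        ≈⟨ reflexive (P.cong (λ m → prodTo m (λ i → blockC (count (suc i) (0 ∷ w)))) lw) ⟩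
      prodTo (c + (length g ∸ c + suc (length y))) (λ i → blockC (count (suc i) (0 ∷ w)))
        ≈⟨ prodTo-split c _ _ ⟩
      prodTo c (λ i → blockC (count (suc i) (0 ∷ w))) * prodTo (length g ∸ c + suc (length y)) (λ i → blockC (count (suc (c + i)) (0 ∷ w)))
        ≈⟨ *-cong (prodTo-cong c (λ i i<c → reflexive (P.cong blockC (left i i<c))))
                  (prodTo-cong (length g ∸ c + suc (length y)) (λ i _ → reflexive (P.cong blockC (right i)))) ⟩
      prodTo c (λ i → blockC (count i g)) * prodTo (length g ∸ c + suc (length y)) (λ i → blockC (count (suc i) u))
        ≈⟨ *-cong (sym (trans (blockSizes-prod g) (prodTo-extend c (length g) _ c≤ (λ k c≤k → reflexive (P.cong blockC (gabs k c≤k))))))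
                  (sym (trans (blocksAfterFirst-prod y) (sym (prodTo-extend (length y) _ _ ly≤ (λ k y≤k → reflexive (P.cong blockC (uabs k y≤k))))))) ⟩
      prodR (map C (blockSizes g)) * blocksAfterFirst y ∎
      where
      u = 0 ∷ y
      w = map suc g ++ 0 ∷ map (relabel c) y
      lw : length w P.≡ c + (length g ∸ c + suc (length y))
      lw = P.trans (length-++ (map suc g))
             (P.trans (P.cong₂ _+_ (length-map suc g) (P.cong suc (length-map (relabel c) y)))
             (P.trans (P.cong (_+ suc (length y)) (P.sym (NP.m+[n∸m]≡n c≤))) (NP.+-assoc c (length g ∸ c) (suc (length y)))))
      ly≤ : length y ≤ length g ∸ c + suc (length y)
      ly≤ = NP.≤-trans (NP.n≤1+n _) (NP.m≤n+m _ _)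
      left : ∀ i → i < c → count (suc i) (0 ∷ w) P.≡ count i g
      left = count-splitFirst-old g c y
      right : ∀ i → count (suc (c + i)) (0 ∷ w) P.≡ count (suc i) u
      right i = count-splitFirst-new g c y i hg
      gabs : ∀ k → c ≤ k → count k g P.≡ 0
      gabs = count-bounded g c hg
      uabs : ∀ k → length y ≤ k → count (suc k) u P.≡ 0
      uabs = count-beyond y hy


module RGSSums {c ℓ} (R : CommutativeRing c ℓ) where

  open import Data.Nat using (ℕ; zero; suc; _+_; _∸_; _<_; _≡ᵇ_; _≤ᵇ_)
  import Data.Nat.Properties as NP
  open import Data.Bool using (Bool; true; false; _∧_; _∨_)
  open import Data.List using (List; []; _∷_; _++_; map; upTo; length)
  open import Data.Product using (_,_)
  open import Data.Unit using (tt)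
  open import Function using (_∘_)
  import Relation.Binary.PropositionalEquality as P
  open CommutativeRing R renaming (_+_ to _+R_)
  open import Relation.Binary.Reasoning.Setoid setoid
  open import Algebra.Solver.Ring.NaturalCoefficients.Default commutativeSemiring using (solve; _:+_; _:=_)
  open Formulas R using (sumR)
  open NoncrossingRGS
  open PowerSeries R using (sumTo; sumTo-cong; sumTo-+; sumTo-swap; sumTo-0; sumTo-split)
  open ListFolds R

  sumOver : (List ℕ → Carrier) → List (List ℕ) → Carrier
  sumOver h xs = sumR (map h xs)

  rgs-sum-cons : ∀ r k (F : List ℕ → Carrier) → sumOver F (rgsAux (suc r) k) ≈ sumTo (suc k) (λ a → sumOver (λ y → F (a ∷ y)) (rgsAux r (grow k a)))
  rgs-sum-cons r k F = trans (sumMap-concatMap F (λ a → map (a ∷_) (rgsAux r (grow k a))) (upTo (suc k)))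
    (trans (sumMap-upTo (λ a → sumOver F (map (a ∷_) (rgsAux r (grow k a)))) (suc k))
           (sumTo-cong (suc k) (λ a _ → sumMap-map F (a ∷_) (rgsAux r (grow k a)))))

  rgs-sum-cong : ∀ r k {h h' : List ℕ → Carrier} → (∀ g → IsRGS k g → length g P.≡ r → h g ≈ h' g) → sumOver h (rgsAux r k) ≈ sumOver h' (rgsAux r k)
  rgs-sum-cong zero k hyp = +-congʳ (hyp [] tt P.refl)
  rgs-sum-cong (suc r) k {h} {h'} hyp = trans (rgs-sum-cons r k h) (trans (sumTo-cong (suc k) (λ a a< →
      rgs-sum-cong r (grow k a) (λ g v lg → hyp (a ∷ g) (NP.≤-pred a< , v) (P.cong suc lg)))) (sym (rgs-sum-cons r k h')))

  grow-suc : ∀ k a → grow (suc k) (suc a) P.≡ suc (grow k a)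
  grow-suc k a with a ≡ᵇ k
  ... | true = P.refl
  ... | false = P.refl

  -- Continuations after k + 1 labels (label 0 included) either avoid 0 — then
  -- they are g + 1 for a continuation g after k labels — or they are
  -- (g + 1) 0 y with the first return to 0 at position j = #g.
  rgs-sum-firstBlock : ∀ r k (F : List ℕ → Carrier) → sumOver F (rgsAux r (suc k)) ≈
    sumOver (F ∘ map suc) (rgsAux r k) +R sumTo r (λ j → sumOver (λ g → sumOver (λ y → F (map suc g ++ 0 ∷ y)) (rgsAux (r ∸ suc j) (suc (labelsUsed k g)))) (rgsAux j k))
  rgs-sum-firstBlock zero k F = sym (+-identityʳ _)
  rgs-sum-firstBlock (suc r) k F = begin
    sumOver F (rgsAux (suc r) (suc k))
      ≈⟨ rgs-sum-cons r (suc k) F ⟩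
    X0 +R sumTo (suc k) (λ a → sumOver (λ y → F (suc a ∷ y)) (rgsAux r (grow (suc k) (suc a))))
      ≈⟨ +-congˡ (sumTo-cong (suc k) (λ a _ → trans (reflexive (P.cong (λ m → sumOver (λ y → F (suc a ∷ y)) (rgsAux r m)) (grow-suc k a)))
                                                     (rgs-sum-firstBlock r (grow k a) (λ y → F (suc a ∷ y))))) ⟩
    X0 +R sumTo (suc k) (λ a → Pa a +R sumTo r (Qa a))
      ≈⟨ +-congˡ (trans (sumTo-+ (suc k) Pa (λ a → sumTo r (Qa a))) (+-congˡ (sumTo-swap (suc k) r Qa))) ⟩
    X0 +R (sumTo (suc k) Pa +R sumTo r (λ j → sumTo (suc k) (λ a → Qa a j)))
      ≈⟨ solve 3 (λ x p q → (x :+ (p :+ q)) := (p :+ (x :+ q))) refl X0 _ _ ⟩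
    sumTo (suc k) Pa +R (X0 +R sumTo r (λ j → sumTo (suc k) (λ a → Qa a j)))
      ≈⟨ +-cong (sym (rgs-sum-cons r k (F ∘ map suc))) (+-cong (sym (+-identityʳ X0))
                (sumTo-cong r (λ j _ → sym (rgs-sum-cons j k (λ g → sumOver (λ y → F (map suc g ++ 0 ∷ y)) (rgsAux (r ∸ suc j) (suc (labelsUsed k g)))))))) ⟩
    sumOver (F ∘ map suc) (rgsAux (suc r) k) +R sumTo (suc r) (λ j → sumOver (λ g → sumOver (λ y → F (map suc g ++ 0 ∷ y)) (rgsAux (suc r ∸ suc j) (suc (labelsUsed k g)))) (rgsAux j k)) ∎
    where
    X0 = sumOver (λ y → F (0 ∷ y)) (rgsAux r (suc k))
    Pa : ℕ → Carrier
    Pa a = sumOver (λ g → F (suc a ∷ map suc g)) (rgsAux r (grow k a))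
    Qa : ℕ → ℕ → Carrier
    Qa a j = sumOver (λ g → sumOver (λ y → F (suc a ∷ (map suc g ++ 0 ∷ y))) (rgsAux (r ∸ suc j) (suc (labelsUsed (grow k a) g)))) (rgsAux j (grow k a))

  isOldLabel : ℕ → ℕ → Bool
  isOldLabel c a = (1 ≤ᵇ a) ∧ (a ≤ᵇ c)

  hitsOldLabel : ℕ → List ℕ → Bool
  hitsOldLabel c [] = false
  hitsOldLabel c (a ∷ y) = isOldLabel c a ∨ hitsOldLabel c y

  ∨-true : ∀ b → b ∨ true P.≡ true
  ∨-true true = P.refl
  ∨-true false = P.refl

  grow-+ : ∀ c d i → grow (c + d) (c + i) P.≡ c + grow d i
  grow-+ zero d i = P.refl
  grow-+ (suc c) d i = P.trans (grow-suc (c + d) (c + i)) (P.cong suc (grow-+ c d i))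

  rgs-sum-relabel : ∀ m c d (F : List ℕ → Carrier) → (∀ y → hitsOldLabel c y P.≡ true → F y ≈ 0#) →
    sumOver F (rgsAux m (suc (c + d))) ≈ sumOver (F ∘ map (relabel c)) (rgsAux m (suc d))
  rgs-sum-relabel zero c d F hF = refl
  rgs-sum-relabel (suc m) c d F hF = begin
    sumOver F (rgsAux (suc m) (suc (c + d)))
      ≈⟨ rgs-sum-cons m (suc (c + d)) F ⟩
    T0 +R sumTo (suc (c + d)) G
      ≈⟨ +-cong (rgs-sum-relabel m c d (λ y → F (0 ∷ y)) (λ y h → hF (0 ∷ y) h))
                (trans (reflexive (P.cong (λ n → sumTo n G) (P.sym (NP.+-suc c d)))) (sumTo-split c (suc d) G)) ⟩
    T0' +R (sumTo c G +R sumTo (suc d) (λ i → G (c + i)))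
      ≈⟨ +-congˡ (trans (+-congʳ (sumTo-0 c (λ a a<c → sumMap-0 _ (rgsAux m (grow (suc (c + d)) (suc a)))
                                   (λ y → hF (suc a ∷ y) (P.cong (_∨ hitsOldLabel c y) (true-T (NP.≤⇒≤ᵇ a<c)))))))
                        (+-identityˡ _)) ⟩
    T0' +R sumTo (suc d) (λ i → G (c + i))
      ≈⟨ +-congˡ (sumTo-cong (suc d) (λ i _ → trans (reflexive (P.cong (λ n → sumOver (λ y → F (suc (c + i) ∷ y)) (rgsAux m n))
                     (P.trans (grow-suc (c + d) (c + i)) (P.cong suc (grow-+ c d i)))))
                   (trans (rgs-sum-relabel m c (grow d i) (λ y → F (suc (c + i) ∷ y)) (λ y h → hF (suc (c + i) ∷ y) (P.trans (P.cong (isOldLabel c (suc (c + i)) ∨_) h) (∨-true _))))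
                          (reflexive (P.cong (λ n → sumOver (λ y → F (suc (c + i) ∷ map (relabel c) y)) (rgsAux m n)) (P.sym (grow-suc d i))))))) ⟩
    T0' +R sumTo (suc d) (λ i → sumOver (λ y → F (suc (c + i) ∷ map (relabel c) y)) (rgsAux m (grow (suc d) (suc i))))
      ≈⟨ sym (rgs-sum-cons m (suc d) (F ∘ map (relabel c))) ⟩
    sumOver (F ∘ map (relabel c)) (rgsAux (suc m) (suc d)) ∎
    where
    T0 = sumOver (λ y → F (0 ∷ y)) (rgsAux m (suc (c + d)))
    T0' = sumOver (λ y → F (0 ∷ map (relabel c) y)) (rgsAux m (suc d))
    G : ℕ → Carrier
    G a = sumOver (λ y → F (suc a ∷ y)) (rgsAux m (grow (suc (c + d)) (suc a)))


-- In a noncrossing partition of {0, …, r} let the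
-- block of 0 be {0 = b₀ < b₁ < … < b_k}.  The gaps between consecutive bᵢ
-- carry noncrossing partitions of some sizes g₁, …, g_k, each contributing
-- δ_{gᵢ} M_{gᵢ} (the arc weight and the moment of the gap), and the elements
-- after b_k carry one more noncrossing partition (contributing M).  Hence
-- M_{r+1} = Σ_k C_{k+1} (Yᵏ M)_r with Y = Σ_g δ_g M_g z^{g+1}.  On RGS this
-- is proved one return to 0 at a time, with a weight φ(#B) in place of C_{#B}.
module MomentRecursion {c ℓ} (R : CommutativeRing c ℓ) where

  open import Data.Nat using (ℕ; zero; suc; _+_; _∸_; _<_; _≤_; z≤n; s≤s)
  import Data.Nat.Properties as NP
  open import Data.Bool using (true; false; if_then_else_; _∧_; not)
  open import Data.List using (List; []; _∷_; _++_; map; length)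
  open import Data.Product using (_×_; _,_; Σ)
  open import Function using (_∘_)
  import Relation.Binary.PropositionalEquality as P
  open CommutativeRing R renaming (_+_ to _+R_)
  open import Relation.Binary.Reasoning.Setoid setoid
  open import Algebra.Solver.Ring.NaturalCoefficients.Default commutativeSemiring using (solve; _:*_; _:=_)
  open Formulas R using (prodR)
  open NoncrossingRGS
  open NoncrossingWeights R
  open RGSSums R
  open PowerSeries R
  open ListFolds R

  count0-shifted : ∀ g → count 0 (map suc g) P.≡ 0
  count0-shifted [] = P.refl
  count0-shifted (a ∷ g) = count0-shifted g

  hitsOldLabel-witness : ∀ c y → hitsOldLabel c y P.≡ true → Σ ℕ (λ t → (t < length y) × (isOldLabel c (at y t) P.≡ true))
  hitsOldLabel-witness c (a ∷ y) h with isOldLabel c a in eq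
  ... | true = 0 , s≤s z≤n , eq
  ... | false = let (t , t< , e') = hitsOldLabel-witness c y h in (suc t , s≤s t< , e')

  isOldLabel-sound : ∀ c a → isOldLabel c a P.≡ true → Σ ℕ (λ a' → (a P.≡ suc a') × (a' < c))
  isOldLabel-sound c zero ()
  isOldLabel-sound c (suc a') h = a' , P.refl , NP.≤ᵇ⇒≤ (suc a') c (T-true h)

  module FirstBlock (C δ : ℕ → Carrier) where
    open ArcWeights δ
    open BlockProducts C

    M : ℕ → Carrier
    M = Formulas.M R C δ

    blockProd : List ℕ → Carrier
    blockProd g = prodR (map C (blockSizes g))

    ncTerm : List ℕ → Carrier
    ncTerm g = if isNoncrossing g then wtN g * blockProd g else 0#

    M-as-rgs-sum : ∀ j → M j ≈ sumOver ncTerm (rgsAux j 0)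
    M-as-rgs-sum j = sumMap-filter (λ p → wtN p * blockProd p) isNoncrossing (rgsAux j 0)

    firstBlockTerm : (ℕ → Carrier) → List ℕ → Carrier
    firstBlockTerm φ y = if isNoncrossing (0 ∷ y) then wtN (0 ∷ y) * (φ (count 0 (0 ∷ y)) * blocksAfterFirst y) else 0#

    firstBlockSum : (ℕ → Carrier) → ℕ → Carrier
    firstBlockSum φ r = sumOver (firstBlockTerm φ) (rgsAux r 1)

    -- every RGS of positive length starts with 0
    M-suc-as-firstBlockSum : ∀ r → M (suc r) ≈ firstBlockSum C r
    M-suc-as-firstBlockSum r = trans (M-as-rgs-sum (suc r)) (trans (rgs-sum-cons r 0 ncTerm) (+-identityʳ _))

    M-0 : M 0 ≈ 1#
    M-0 = trans (+-identityʳ _) (*-identityʳ _)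

    term-singletonFirst : ∀ φ g → firstBlockTerm φ (map suc g) ≈ φ 1 * ncTerm g
    term-singletonFirst φ g = trans (reflexive (P.cong (λ b → if b then X else 0#) (nc-singletonFirst g))) (go (isNoncrossing g))
      where
      X = wtN (0 ∷ map suc g) * (φ (count 0 (0 ∷ map suc g)) * blocksAfterFirst (map suc g))
      go : ∀ b → (if b then X else 0#) ≈ φ 1 * (if b then wtN g * blockProd g else 0#)
      go true = trans (*-cong (wtN-singletonFirst g) (*-cong (reflexive (P.cong (φ ∘ suc) (count0-shifted g))) (blocks-singletonFirst g)))
                      (solve 3 (λ w a p → (w :* (a :* p)) := (a :* (w :* p))) refl _ _ _)
      go false = sym (zeroʳ _)

    term-splitFirst : ∀ φ g y → IsRGS 0 g → IsRGS 1 y →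
      firstBlockTerm φ (map suc g ++ 0 ∷ map (relabel (labelsUsed 0 g)) y) ≈ ncTerm g * (δ (length g) * firstBlockTerm (φ ∘ suc) y)
    term-splitFirst φ g y vg vy = trans (reflexive (P.cong (λ b → if b then X else 0#) (nc-splitFirst g cc y hg))) (go (isNoncrossing g) (isNoncrossing (0 ∷ y)))
      where
      cc = labelsUsed 0 g
      w = map suc g ++ 0 ∷ map (relabel cc) y
      X = wtN (0 ∷ w) * (φ (count 0 (0 ∷ w)) * blocksAfterFirst w)
      hg : ∀ s → s < length g → at g s < cc
      hg = rgs-bound 0 g vg
      hy : ∀ t → t < length y → at y t ≤ length y
      hy t t< = NP.≤-pred (NP.<-≤-trans (rgs-bound 1 y vy t t<) (labelsUsed≤ 1 y))
      cw : count 0 (0 ∷ w) P.≡ suc (count 0 (0 ∷ y))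
      cw = P.cong suc (P.trans (count-++ 0 (map suc g) (0 ∷ map (relabel cc) y))
             (P.trans (P.cong (_+ count 0 (0 ∷ map (relabel cc) y)) (count0-shifted g)) (count-map (relabel cc) (relabel-injective cc) 0 (0 ∷ y))))
      Wg = wtN g
      Wu = wtN (0 ∷ y)
      Ry = blocksAfterFirst y
      cu = count 0 (0 ∷ y)
      go : ∀ b1 b2 → (if b1 ∧ b2 then X else 0#) ≈ (if b1 then Wg * blockProd g else 0#) * (δ (length g) * (if b2 then Wu * (φ (suc cu) * Ry) else 0#))
      go true true = trans (*-cong (wtN-splitFirst g cc y hg) (*-cong (reflexive (P.cong φ cw)) (blocks-splitFirst g cc y hg (labelsUsed≤ 0 g) hy)))
                           (solve 7 (λ d wg wu f pg ry pgg → ((d :* (wg :* wu)) :* (f :* (pg :* ry))) := ((wg :* pg) :* (d :* (wu :* (f :* ry))))) refl _ _ _ _ _ _ (blockProd g))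
      go true false = sym (trans (*-congˡ (zeroʳ _)) (zeroʳ _))
      go false b2 = sym (zeroˡ _)

    term-crossingFirst : ∀ φ g y → IsRGS 0 g → hitsOldLabel (labelsUsed 0 g) y P.≡ true → firstBlockTerm φ (map suc g ++ 0 ∷ y) ≈ 0#
    term-crossingFirst φ g y vg h with hitsOldLabel-witness (labelsUsed 0 g) y h
    ... | t , t< , old with isOldLabel-sound (labelsUsed 0 g) (at y t) old
    ...   | a' , eq , a'< with rgs-occ 0 g vg a' z≤n a'<
    ...     | s , s< , es = reflexive (P.cong (λ b → if b then X else 0#) (nc-crossingFirst g y s t s< t< (P.trans (P.cong suc es) (P.sym eq))))
      where X = wtN (0 ∷ (map suc g ++ 0 ∷ y)) * (φ (count 0 (0 ∷ (map suc g ++ 0 ∷ y))) * blocksAfterFirst (map suc g ++ 0 ∷ y))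

    -- T_φ(r) = φ₁ M_r + Σ_j δ_j M_j T_{φ ∘ suc}(r − j − 1): either the block of
    -- 0 is a singleton, or its next element follows a noncrossing gap of size j.
    firstBlockSum-rec : ∀ φ r → firstBlockSum φ r ≈ φ 1 * M r +R sumTo r (λ j → δ j * M j * firstBlockSum (φ ∘ suc) (r ∸ suc j))
    firstBlockSum-rec φ r = trans (rgs-sum-firstBlock r 0 (firstBlockTerm φ)) (+-cong singleton-case (sumTo-cong r (λ j _ → return-case j)))
      where
      singleton-case : sumOver (firstBlockTerm φ ∘ map suc) (rgsAux r 0) ≈ φ 1 * M r
      singleton-case = trans (sumMap-cong (rgsAux r 0) (term-singletonFirst φ)) (trans (sumMap-*ˡ (φ 1) ncTerm (rgsAux r 0)) (*-congˡ (sym (M-as-rgs-sum r))))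
      return-case : ∀ j → sumOver (λ g → sumOver (λ y → firstBlockTerm φ (map suc g ++ 0 ∷ y)) (rgsAux (r ∸ suc j) (suc (labelsUsed 0 g)))) (rgsAux j 0) ≈
                    δ j * M j * firstBlockSum (φ ∘ suc) (r ∸ suc j)
      return-case j = trans (rgs-sum-cong j 0 (λ g vg lg → after-gap g vg lg))
        (trans (sumMap-*ʳ (δ j * firstBlockSum (φ ∘ suc) m) ncTerm (rgsAux j 0))
        (trans (*-congʳ (sym (M-as-rgs-sum j))) (solve 3 (λ a b d → (a :* (d :* b)) := (d :* a :* b)) refl (M j) (firstBlockSum (φ ∘ suc) m) (δ j))))
        where
        m = r ∸ suc j
        after-gap : ∀ g → IsRGS 0 g → length g P.≡ j → sumOver (λ y → firstBlockTerm φ (map suc g ++ 0 ∷ y)) (rgsAux m (suc (labelsUsed 0 g))) ≈ ncTerm g * (δ j * firstBlockSum (φ ∘ suc) m)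
        after-gap g vg lg = begin
          sumOver (λ y → firstBlockTerm φ (map suc g ++ 0 ∷ y)) (rgsAux m (suc (labelsUsed 0 g)))
            ≈⟨ reflexive (P.cong (λ n → sumOver (λ y → firstBlockTerm φ (map suc g ++ 0 ∷ y)) (rgsAux m (suc n))) (P.sym (NP.+-identityʳ (labelsUsed 0 g)))) ⟩
          sumOver (λ y → firstBlockTerm φ (map suc g ++ 0 ∷ y)) (rgsAux m (suc (labelsUsed 0 g + 0)))
            ≈⟨ rgs-sum-relabel m (labelsUsed 0 g) 0 (λ y → firstBlockTerm φ (map suc g ++ 0 ∷ y)) (λ y h → term-crossingFirst φ g y vg h) ⟩
          sumOver (λ y → firstBlockTerm φ (map suc g ++ 0 ∷ map (relabel (labelsUsed 0 g)) y)) (rgsAux m 1)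
            ≈⟨ rgs-sum-cong m 1 (λ y vy _ → trans (term-splitFirst φ g y vg vy) (*-congˡ (*-congʳ (reflexive (P.cong δ lg))))) ⟩
          sumOver (λ y → ncTerm g * (δ j * firstBlockTerm (φ ∘ suc) y)) (rgsAux m 1)
            ≈⟨ trans (sumMap-*ˡ (ncTerm g) (λ y → δ j * firstBlockTerm (φ ∘ suc) y) (rgsAux m 1)) (*-congˡ (sumMap-*ˡ (δ j) (firstBlockTerm (φ ∘ suc)) (rgsAux m 1))) ⟩
          ncTerm g * (δ j * firstBlockSum (φ ∘ suc) m) ∎

    Y : Seq
    Y = shift (λ g → δ g * M g)

    firstBlockSum-series : ∀ φ r → firstBlockSum φ r ≈ φ 1 * M r +R (Y ⊛ firstBlockSum (φ ∘ suc)) r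
    firstBlockSum-series φ r = trans (firstBlockSum-rec φ r)
      (+-congˡ (sym (trans (⊛-coeff Y (firstBlockSum (φ ∘ suc)) r) (trans (+-congʳ (zeroˡ _)) (+-identityˡ _)))))

    firstBlockSum-closed : ∀ B r → r < B → ∀ φ → firstBlockSum φ r ≈ sumTo (suc r) (λ k → φ (suc k) * (pow Y k ⊛ M) r)
    firstBlockSum-closed (suc B) r r<B φ = begin
      firstBlockSum φ r ≈⟨ firstBlockSum-series φ r ⟩
      φ 1 * M r +R (Y ⊛ firstBlockSum (φ ∘ suc)) r
        ≈⟨ +-congˡ (⊛-local Y refl r (λ j j<r → trans (firstBlockSum-closed B j (NP.≤-trans j<r (NP.≤-pred r<B)) (φ ∘ suc))
              (sym (sumTo-extend (suc j) (suc r) (λ k → φ (suc (suc k)) * (pow Y k ⊛ M) j) (NP.≤-trans j<r (NP.n≤1+n r))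
                     (λ k sj≤k → *0≈ _ (YᵏM-order k j sj≤k)))))) ⟩
      φ 1 * M r +R (Y ⊛ (λ j → sumTo (suc r) (λ k → φ (suc (suc k)) * (pow Y k ⊛ M) j))) r
        ≈⟨ +-congˡ (⊛-sumTo Y (suc r) (φ ∘ suc ∘ suc) (λ k → pow Y k ⊛ M) r) ⟩
      φ 1 * M r +R sumTo (suc r) (λ k → φ (suc (suc k)) * (Y ⊛ (pow Y k ⊛ M)) r)
        ≈⟨ +-cong (*-congˡ (sym (one⊛ M r)))
             (trans (sumTo-cong (suc r) {f = λ k → φ (suc (suc k)) * (Y ⊛ (pow Y k ⊛ M)) r} (λ k _ → *-congˡ (sym (⊛-assoc Y (pow Y k) M r))))
             (trans (sumTo-last r (λ k → φ (suc (suc k)) * (pow Y (suc k) ⊛ M) r))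
                    (trans (+-congˡ (*0≈ _ (YᵏM-order (suc r) r (NP.n<1+n r)))) (+-identityʳ _)))) ⟩
      φ 1 * (one ⊛ M) r +R sumTo r (λ k → φ (suc (suc k)) * (pow Y (suc k) ⊛ M) r) ∎
      where
      YᵏM-order : ∀ k j → j < k → (pow Y k ⊛ M) j ≈ 0#
      YᵏM-order k = order-⊛ (pow Y k) M k (λ i i<k → pow-order Y refl k i i<k)

    M-recursion : ∀ r → M (suc r) ≈ sumTo (suc r) (λ k → C (suc k) * (pow Y k ⊛ M) r)
    M-recursion r = trans (M-suc-as-firstBlockSum r) (firstBlockSum-closed (suc r) r NP.≤-refl C)


theorem4p8 : {c ℓ : Level} (R : CommutativeRing c ℓ)
    (C : ℕ → CommutativeRing.Carrier R) (δ : ℕ → CommutativeRing.Carrier R) →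
    CommutativeRing._≈_ R (δ 0) (CommutativeRing.1# R) →
    (n : ℕ) → 1 ≤ n →
    CommutativeRing._≈_ R (C n) (Formulas.rhs R C δ n)
theorem4p8 R C δ hδ n 1≤n = sym (Rt≈C n 1≤n)
  where
  open CommutativeRing R using (sym; refl)
  open MomentRecursion.FirstBlock R C δ using (M; M-0; M-recursion)
  open SchroederSeries.TreeSums R M δ using (A; B; A-equation; B-equation)
  open SchroederSeries.RhsAsCoefficient R C δ using (rhs-coeff)
  open InversionArgument.Inversion R C δ M A B (Formulas.rhs R C δ) hδ M-0 M-recursion refl refl B-equation A-equation rhs-coeff
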